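{- Let $b$ be a prime. The Faure $(0,b)$-sequence in base $b$ is not a quasi-uniform sequence; that is, there is no constant $C$ such that $\rho_\infty(P_i)\le C$ for all $i\ge1$, where $P_i$ is the set of the first $i$ points of the sequence.
   Context: The Faure $(0,b)$-sequence in base $b$ is the $b$-dimensional digital sequence over $\mathbb{F}_b$ with generating matrices $I,P,\ldots,P^{b-1}$, where $P_{i,j}=\binom{j-1}{i-1}\bmod b$ ($i,j\ge1$); for $n=n_0+n_1b+\cdots$, $\vec n=(n_0,n_1,\ldots)^\top$, the $j$-th coordinate of the $n$-th point is $\sum_{k\ge1}x_{n,j,k}b^{ -k}$ where $(x_{n,j,1},x_{n,j,2},\ldots)^\top=P^{j-1}\vec n$ over $\mathbb{F}_b$. For finite $Q\subset[0,1]^d$: $h_\infty(Q)=\sup_{\boldsymbol{x}\in[0,1]^d}\min_{\boldsymbol{y}\in Q}\|\boldsymbol{x}-\boldsymbol{y}\|_\infty$, $q_\infty(Q)=\min_{\boldsymbol{x}\ne\boldsymbol{y}\in Q}\|\boldsymbol{x}-\boldsymbol{y}\|_\infty/2$, $\rho_\infty(Q)=h_\infty(Q)/q_\infty(Q)$. (Quasi-uniformity does not depend on the choice of $\ell_p$ norm.)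
   Formalization: The constant C ranges over ℚ, and the points x in the supremum defining $h_\infty$ are taken in the points of the unit cube with rational coordinates. -}

module Defs where

open import Data.Nat as ℕ using (ℕ; zero; suc; _∸_; NonZero; nonTrivial⇒nonZero)
open import Data.Nat.DivMod using (_/_; _%_)
open import Data.Nat.Combinatorics using (_C_)
open import Data.Nat.Properties using (m^n≢0)
open import Data.Nat.Primality using (Prime)
open import Data.Fin using (Fin; toℕ)
import Data.Fin as Fin
open import Data.Integer using (+_)
open import Data.Rational as ℚ using (ℚ; 0ℚ; 1ℚ; ½; _⊔_; _⊓_; ∣_∣; _-_; _<_; _≤_)
open import Data.Product using (Σ; _×_)

primeNZ : ∀ {b} → Prime b → NonZero b
primeNZ {b} record{} = nonTrivial⇒nonZero b

sumℕ : ℕ → (ℕ → ℕ) → ℕ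
sumℕ zero    f = 0
sumℕ (suc L) f = sumℕ L f ℕ.+ f L

sumℚ : ℕ → (ℕ → ℚ) → ℚ
sumℚ zero    f = 0ℚ
sumℚ (suc L) f = sumℚ L f ℚ.+ f L

module _ (b : ℕ) .{{_ : NonZero b}} where

  digit : ℕ → ℕ → ℕ
  digit n zero    = n % b
  digit n (suc k) = digit (n / b) k

  -- number of digits used for index n; n < b^(n+1) so all nonzero digits of n
  -- are among the first (suc n).  Since P (hence every P^j) is upper triangular,
  -- (P^j n⃗)_k = 0 for k ≥ suc n, so truncating to this block is exact.
  len : ℕ → ℕ
  len n = suc n

  -- one application of the Pascal matrix P over F_b (0-indexed:
  -- P_{k,m} = binom(m,k) mod b), on vectors supported on {0,…,L-1}
  applyP : ℕ → (ℕ → ℕ) → (ℕ → ℕ)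
  applyP L v k = sumℕ L (λ m → (m C k) ℕ.* v m) % b

  powP : ℕ → ℕ → (ℕ → ℕ) → (ℕ → ℕ)
  powP L zero    v = v
  powP L (suc j) v = applyP L (powP L j v)

  faureCoord : ℕ → ℕ → ℚ
  faureCoord j n =
    sumℚ (len n) (λ k → ℚ._/_ (+ powP (len n) j (digit n) k) (b ℕ.^ suc k)
                                 {{m^n≢0 b (suc k)}})

  faure : ℕ → (Fin b → ℚ)
  faure n j = faureCoord (toℕ j) n

maxFin : ∀ {d} → (Fin d → ℚ) → ℚ
maxFin {zero}  f = 0ℚ
maxFin {suc d} f = f Fin.zero ⊔ maxFin (λ i → f (Fin.suc i))

dist∞ : ∀ {d} → (Fin d → ℚ) → (Fin d → ℚ) → ℚ
dist∞ x y = maxFin (λ i → ∣ x i - y i ∣)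

-- minimum of f 0, …, f (N-1)  (N ≥ 1; junk value 0 for N = 0)
minUpTo : ℕ → (ℕ → ℚ) → ℚ
minUpTo zero          f = 0ℚ
minUpTo (suc zero)    f = f 0
minUpTo (suc (suc N)) f = minUpTo (suc N) f ⊓ f (suc N)

-- Point sets P_N = {p 0, …, p (N-1)} given by a sequence p.

sepRadius : ∀ {d} → (ℕ → (Fin d → ℚ)) → ℕ → ℚ
sepRadius p N =
  ½ ℚ.* minUpTo (N ∸ 1) (λ n → minUpTo (suc n) (λ m → dist∞ (p m) (p (suc n))))

InCube : ∀ {d} → (Fin d → ℚ) → Set
InCube x = ∀ i → (0ℚ ≤ x i) × (x i ≤ 1ℚ)

-- r < h_∞(P_N) = sup_{x ∈ [0,1]^d} min_{n < N} ‖x - p n‖_∞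
-- (unfolding of the strict lower bound on the supremum)
FillDistExceeds : ∀ {d} → (ℕ → (Fin d → ℚ)) → ℕ → ℚ → Set
FillDistExceeds {d} p N r =
  Σ (Fin d → ℚ) λ x → InCube x × (∀ n → n ℕ.< N → r < dist∞ x (p n))

-- C < ρ_∞(P_N) = h_∞(P_N) / q_∞(P_N)   (q_∞(P_N) > 0), i.e.  C · q_∞ < h_∞
MeshRatioExceeds : ∀ {d} → (ℕ → (Fin d → ℚ)) → ℕ → ℚ → Set
MeshRatioExceeds p N C = FillDistExceeds p N (C ℚ.* sepRadius p N)

-- Read the digits (n₀, n₁, …) of n as the polynomial f = n₀ + n₁ X + ⋯ over 𝔽_b. The Pascal matrix
-- P acts as f(X) ↦ f(X + 1), so the digits of the j-th coordinate of the n-th point form the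
-- polynomial f(X + j); and for R a power of b, (X + j)^R = X^R + j (Frobenius, Fermat).
--
-- All coordinates of point 1 equal 1/b. Let L = (b − 1) R and n = b^L − b, with digit polynomial
-- (b − 1)(X + ⋯ + X^(L−1)) = 1 − (X^L − 1)/(X − 1). Its first coordinate is 1/b − b^(−L). For
-- j ≠ 0, (X + j)^L = (X^R + j)^(b−1) ≡ 1 modulo X^R, so ((X + j)^L − 1)/(X + j − 1) vanishes
-- modulo X^(R−1): coordinate j has digits 1, 0, …, 0 in its first R − 1 places. Hence points 1
-- and n are within b^(1−R) of each other, and the separation radius of the first n + 1 points is
-- at most b^(1−R)/2. On the other hand, cutting the cube into G^b = b^L > n + 1 boxes of side 1/G
-- leaves a box without points, whose centre is at distance at least 1/(2G) from all of them. The
-- mesh ratio is therefore at least b^(R−1)/G = b^(R/b − 1), which is unbounded in R.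

module Submission where

open import Defs
open import Data.Nat using (ℕ; _≤_)
open import Data.Nat.Primality using (Prime)
open import Data.Rational using (ℚ)
open import Data.Product using (Σ; _×_)

open import Data.Nat as ℕ using (_<_; suc; NonZero; nonTrivial⇒n>1)
import Data.Nat.Properties as ℕ
open import Data.Nat.Primality using (prime⇒nonTrivial)
open import Data.Rational as ℚ using (½)
import Data.Rational.Properties as ℚ
open import Data.Product using (_,_; proj₁; proj₂)


module FiniteSums where

  open import Data.Nat
  open import Data.Nat.Properties
  open import Data.Nat.Tactic.RingSolver using (solve-∀)
  open import Data.Sum using (inj₁; inj₂)
  open import Relation.Binary.PropositionalEquality
  open import Relation.Nullary using (yes; no; contradiction)

  sumℕ-cong : ∀ L {f g : ℕ → ℕ} → (∀ m → m < L → f m ≡ g m) → sumℕ L f ≡ sumℕ L g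
  sumℕ-cong zero    f≡g = refl
  sumℕ-cong (suc L) f≡g = cong₂ _+_ (sumℕ-cong L (λ m m<L → f≡g m (m<n⇒m<1+n m<L))) (f≡g L ≤-refl)

  sumℕ-zero : ∀ L {f : ℕ → ℕ} → (∀ m → m < L → f m ≡ 0) → sumℕ L f ≡ 0
  sumℕ-zero L f≡0 = trans (sumℕ-cong L f≡0) (sumℕ-const0 L)
    where
    sumℕ-const0 : ∀ L → sumℕ L (λ _ → 0) ≡ 0
    sumℕ-const0 zero    = refl
    sumℕ-const0 (suc L) = cong (_+ 0) (sumℕ-const0 L)

  sumℕ-+ : ∀ L (f g : ℕ → ℕ) → sumℕ L (λ m → f m + g m) ≡ sumℕ L f + sumℕ L g
  sumℕ-+ zero    f g = refl
  sumℕ-+ (suc L) f g = trans (cong (_+ (f L + g L)) (sumℕ-+ L f g)) (interchange (sumℕ L f) (sumℕ L g) (f L) (g L))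
    where
    interchange : ∀ a b c d → (a + b) + (c + d) ≡ (a + c) + (b + d)
    interchange = solve-∀

  sumℕ-*ˡ : ∀ L c (f : ℕ → ℕ) → sumℕ L (λ m → c * f m) ≡ c * sumℕ L f
  sumℕ-*ˡ zero    c f = sym (*-zeroʳ c)
  sumℕ-*ˡ (suc L) c f = trans (cong (_+ c * f L) (sumℕ-*ˡ L c f)) (sym (*-distribˡ-+ c (sumℕ L f) (f L)))

  sumℕ-sucˡ : ∀ L (f : ℕ → ℕ) → sumℕ (suc L) f ≡ f 0 + sumℕ L (λ m → f (suc m))
  sumℕ-sucˡ zero    f = +-comm 0 (f 0)
  sumℕ-sucˡ (suc L) f = trans (cong (_+ f (suc L)) (sumℕ-sucˡ L f)) (+-assoc (f 0) _ _)

  indicator : ℕ → ℕ → ℕ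
  indicator a i with a ≟ i
  ... | yes _ = 1
  ... | no _  = 0

  indicator-refl : ∀ a → indicator a a ≡ 1
  indicator-refl a with a ≟ a
  ... | yes _   = refl
  ... | no a≢a = contradiction refl a≢a

  indicator-≢ : ∀ a i → a ≢ i → indicator a i ≡ 0
  indicator-≢ a i a≢i with a ≟ i
  ... | yes a≡i = contradiction a≡i a≢i
  ... | no _    = refl

  sumℕ-indicator-out : ∀ a n (F : ℕ → ℕ) → n ≤ a → sumℕ n (λ i → indicator a i * F i) ≡ 0
  sumℕ-indicator-out a n F n≤a =
    sumℕ-zero n (λ i i<n → cong (_* F i) (indicator-≢ a i (λ { refl → <⇒≱ i<n n≤a })))

  sumℕ-indicator-in : ∀ a n (F : ℕ → ℕ) → a < n → sumℕ n (λ i → indicator a i * F i) ≡ F a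
  sumℕ-indicator-in a (suc n) F a<1+n with m≤n⇒m<n∨m≡n (≤-pred a<1+n)
  ... | inj₁ a<n  = trans (cong₂ _+_ (sumℕ-indicator-in a n F a<n) (cong (_* F n) (indicator-≢ a n (<⇒≢ a<n))))
                          (+-identityʳ (F a))
  ... | inj₂ refl = trans (cong₂ _+_ (sumℕ-indicator-out a a F ≤-refl) (cong (_* F a) (indicator-refl a)))
                          (+-identityʳ (F a))


module Polynomials where

  open import Data.Nat
  open import Data.Nat.Properties
  open import Data.Nat.Combinatorics using (_C_; nCk+nC[k+1]≡[n+1]C[k+1]; k>n⇒nCk≡0)
  open import Data.Nat.Tactic.RingSolver using (solve-∀)
  open import Relation.Binary.PropositionalEquality
  open import Relation.Nullary using (yes; no)
  open FiniteSums

  Coeffs : Set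
  Coeffs = ℕ → ℕ

  infixl 6 _⊕_
  _⊕_ : Coeffs → Coeffs → Coeffs
  (f ⊕ g) k = f k + g k

  infixr 7 _⊙_
  _⊙_ : ℕ → Coeffs → Coeffs
  (c ⊙ f) k = c * f k

  one : Coeffs
  one zero    = 1
  one (suc k) = 0

  one<b : ∀ {b} → 1 < b → ∀ k → one k < b
  one<b 1<b zero    = 1<b
  one<b 1<b (suc k) = <-trans z<s 1<b

  infixr 7 X·_ X^_·_
  X·_ : Coeffs → Coeffs
  (X· f) zero    = 0
  (X· f) (suc k) = f k

  X^_·_ : ℕ → Coeffs → Coeffs
  X^ zero  · f = f
  X^ suc m · f = X· (X^ m · f)

  DegreeBelow : ℕ → Coeffs → Set
  DegreeBelow S f = ∀ k → S ≤ k → f k ≡ 0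

  DegreeBelow-mono : ∀ {S S′ f} → S ≤ S′ → DegreeBelow S f → DegreeBelow S′ f
  DegreeBelow-mono S≤S′ deg k S′≤k = deg k (≤-trans S≤S′ S′≤k)

  one-degree : DegreeBelow 1 one
  one-degree (suc k) _ = refl

  X·-degree : ∀ {S f} → DegreeBelow S f → DegreeBelow (suc S) (X· f)
  X·-degree deg (suc k) (s≤s S≤k) = deg k S≤k

  X^·-degree : ∀ m {S f} → DegreeBelow S f → DegreeBelow (m + S) (X^ m · f)
  X^·-degree zero    deg = deg
  X^·-degree (suc m) deg = X·-degree (X^·-degree m deg)

  X^·-below : ∀ m f k → k < m → (X^ m · f) k ≡ 0
  X^·-below (suc m) f zero    _         = refl
  X^·-below (suc m) f (suc k) (s≤s k<m) = X^·-below m f k k<m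

  X^·-at : ∀ m f k → (X^ m · f) (m + k) ≡ f k
  X^·-at zero    f k = refl
  X^·-at (suc m) f k = X^·-at m f k

  X^-+· : ∀ m n f → X^ (m + n) · f ≡ X^ m · X^ n · f
  X^-+· zero    n f = refl
  X^-+· (suc m) n f = cong X·_ (X^-+· m n f)

  X·-cong : ∀ {f g} → (∀ k → f k ≡ g k) → ∀ k → (X· f) k ≡ (X· g) k
  X·-cong f≡g zero    = refl
  X·-cong f≡g (suc k) = f≡g k

  pascalSum : ℕ → Coeffs → Coeffs
  pascalSum L f k = sumℕ L (λ m → (m C k) * f m)

  pascalSum-⊕ : ∀ L f g k → pascalSum L (f ⊕ g) k ≡ pascalSum L f k + pascalSum L g k
  pascalSum-⊕ L f g k = trans (sumℕ-cong L (λ m _ → *-distribˡ-+ (m C k) (f m) (g m))) (sumℕ-+ L _ _)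

  pascalSum-⊙ : ∀ L c f k → pascalSum L (c ⊙ f) k ≡ c * pascalSum L f k
  pascalSum-⊙ L c f k = trans (sumℕ-cong L (λ m _ → x*[c*y]≡c*[x*y] (m C k) c (f m))) (sumℕ-*ˡ L c _)
    where
    x*[c*y]≡c*[x*y] : ∀ x c y → x * (c * y) ≡ c * (x * y)
    x*[c*y]≡c*[x*y] = solve-∀

  pascalSum-degree : ∀ L {S f} → DegreeBelow S f → DegreeBelow S (pascalSum L f)
  pascalSum-degree L {S} {f} deg k S≤k = sumℕ-zero L term≡0
    where
    term≡0 : ∀ m → m < L → (m C k) * f m ≡ 0
    term≡0 m _ with m <? k
    ... | yes m<k = cong (_* f m) (k>n⇒nCk≡0 m<k)
    ... | no m≮k  = trans (cong ((m C k) *_) (deg m (≤-trans S≤k (≮⇒≥ m≮k)))) (*-zeroʳ (m C k))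

  pascalSum-one : ∀ T k → pascalSum (suc T) one k ≡ one k
  pascalSum-one T k = begin
    pascalSum (suc T) one k                       ≡⟨ sumℕ-sucˡ T _ ⟩
    (0 C k) * 1 + sumℕ T (λ m → (suc m C k) * 0) ≡⟨ cong₂ _+_ (*-identityʳ (0 C k)) (sumℕ-zero T (λ m _ → *-zeroʳ (suc m C k))) ⟩
    (0 C k) + 0                                   ≡⟨ +-identityʳ (0 C k) ⟩
    0 C k                                         ≡⟨ 0Ck≡one k ⟩
    one k                                         ∎
    where
    open ≡-Reasoning
    0Ck≡one : ∀ k → 0 C k ≡ one k
    0Ck≡one zero    = refl
    0Ck≡one (suc k) = refl

  -- Pascal's rule C(m+1,k+1) = C(m,k) + C(m,k+1) says that P(X f) = (1 + X) P f.
  pascalSum-X· : ∀ T {g} → DegreeBelow T g → ∀ k →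
                 pascalSum (suc T) (X· g) k ≡ (X· pascalSum (suc T) g) k + pascalSum (suc T) g k
  pascalSum-X· T {g} deg k = begin
    pascalSum (suc T) (X· g) k                 ≡⟨ sumℕ-sucˡ T _ ⟩
    (0 C k) * 0 + sumℕ T (λ m → (suc m C k) * g m)
                                               ≡⟨ cong (_+ sumℕ T (λ m → (suc m C k) * g m)) (*-zeroʳ (0 C k)) ⟩
    sumℕ T (λ m → (suc m C k) * g m)          ≡⟨ split k ⟩
    (X· pascalSum T g) k + pascalSum T g k     ≡⟨ cong₂ _+_ (X·-cong (λ i → sym (drop-last i)) k) (sym (drop-last k)) ⟩
    (X· pascalSum (suc T) g) k + pascalSum (suc T) g k ∎
    where
    open ≡-Reasoning
    drop-last : ∀ i → pascalSum (suc T) g i ≡ pascalSum T g i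
    drop-last i = trans (cong (pascalSum T g i +_) (trans (cong ((T C i) *_) (deg T ≤-refl)) (*-zeroʳ (T C i))))
                        (+-identityʳ (pascalSum T g i))
    split : ∀ k → sumℕ T (λ m → (suc m C k) * g m) ≡ (X· pascalSum T g) k + pascalSum T g k
    split zero    = refl
    split (suc k) = trans (sumℕ-cong T (λ m _ → trans (cong (_* g m) (sym (nCk+nC[k+1]≡[n+1]C[k+1] m k)))
                                                      (*-distribʳ-+ (g m) (m C k) (m C suc k))))
                          (sumℕ-+ T _ _)

  infixr 7 [1+X]^_·_
  [1+X]^_·_ : ℕ → Coeffs → Coeffs
  ([1+X]^ m · h) k = sumℕ (suc k) (λ i → (m C i) * h (k ∸ i))

  [1+X]^0· : ∀ h k → ([1+X]^ 0 · h) k ≡ h k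
  [1+X]^0· h k = begin
    ([1+X]^ 0 · h) k                            ≡⟨ sumℕ-sucˡ k _ ⟩
    1 * h k + sumℕ k (λ i → 0 * h (k ∸ suc i))  ≡⟨ cong (1 * h k +_) (sumℕ-zero k (λ _ _ → refl)) ⟩
    1 * h k + 0                                 ≡⟨ trans (+-identityʳ _) (*-identityˡ _) ⟩
    h k                                         ∎
    where open ≡-Reasoning

  [1+X]^suc· : ∀ m h k → ([1+X]^ suc m · h) k ≡ (X· [1+X]^ m · h) k + ([1+X]^ m · h) k
  [1+X]^suc· m h zero    = refl
  [1+X]^suc· m h (suc k) = begin
    ([1+X]^ suc m · h) (suc k)                                     ≡⟨ sumℕ-sucˡ (suc k) _ ⟩
    1 * h (suc k) + sumℕ (suc k) (λ i → (suc m C suc i) * h (k ∸ i)) ≡⟨ cong (1 * h (suc k) +_) pascal ⟩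
    1 * h (suc k) + (([1+X]^ m · h) k + rest)                      ≡⟨ x+[y+z]≡y+[x+z] (1 * h (suc k)) (([1+X]^ m · h) k) rest ⟩
    ([1+X]^ m · h) k + (1 * h (suc k) + rest)                      ≡⟨ cong (([1+X]^ m · h) k +_) (sumℕ-sucˡ (suc k) _) ⟨
    ([1+X]^ m · h) k + ([1+X]^ m · h) (suc k)                      ∎
    where
    open ≡-Reasoning
    rest = sumℕ (suc k) (λ i → (m C suc i) * h (k ∸ i))
    pascal : sumℕ (suc k) (λ i → (suc m C suc i) * h (k ∸ i)) ≡ ([1+X]^ m · h) k + rest
    pascal = trans (sumℕ-cong (suc k) (λ i _ → trans (cong (_* h (k ∸ i)) (sym (nCk+nC[k+1]≡[n+1]C[k+1] m i)))
                                                      (*-distribʳ-+ (h (k ∸ i)) (m C i) (m C suc i))))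
                   (sumℕ-+ (suc k) _ _)
    x+[y+z]≡y+[x+z] : ∀ x y z → x + (y + z) ≡ y + (x + z)
    x+[y+z]≡y+[x+z] = solve-∀

  pascalSum-X^· : ∀ T m {S g} → DegreeBelow S g → S + m ≤ T → ∀ k →
                  pascalSum (suc T) (X^ m · g) k ≡ ([1+X]^ m · pascalSum (suc T) g) k
  pascalSum-X^· T zero    {S} {g} deg S+m≤T k = sym ([1+X]^0· (pascalSum (suc T) g) k)
  pascalSum-X^· T (suc m) {S} {g} deg S+m≤T k = begin
    pascalSum (suc T) (X· X^ m · g) k
      ≡⟨ pascalSum-X· T (DegreeBelow-mono (≤-trans (≤-reflexive (+-comm m S)) (<⇒≤ S+m<T)) (X^·-degree m deg)) k ⟩
    (X· pascalSum (suc T) (X^ m · g)) k + pascalSum (suc T) (X^ m · g) k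
      ≡⟨ cong₂ _+_ (X·-cong (pascalSum-X^· T m deg (<⇒≤ S+m<T)) k) (pascalSum-X^· T m deg (<⇒≤ S+m<T) k) ⟩
    (X· [1+X]^ m · pascalSum (suc T) g) k + ([1+X]^ m · pascalSum (suc T) g) k
      ≡⟨ [1+X]^suc· m (pascalSum (suc T) g) k ⟨
    ([1+X]^ suc m · pascalSum (suc T) g) k ∎
    where
    open ≡-Reasoning
    S+m<T : S + m < T
    S+m<T = ≤-trans (≤-reflexive (sym (+-suc S m))) S+m≤T

  repunit : ℕ → Coeffs
  repunit zero    k       = 0
  repunit (suc L) zero    = 1
  repunit (suc L) (suc k) = repunit L k

  repunit-degree : ∀ L → DegreeBelow L (repunit L)
  repunit-degree zero    k       _         = refl
  repunit-degree (suc L) (suc k) (s≤s L≤k) = repunit-degree L k L≤k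

  repunit-below : ∀ L k → k < L → repunit L k ≡ 1
  repunit-below (suc L) zero    _         = refl
  repunit-below (suc L) (suc k) (s≤s k<L) = repunit-below L k k<L

  repunit-suc : ∀ L k → repunit (suc L) k ≡ repunit L k + (X^ L · one) k
  repunit-suc zero    zero    = refl
  repunit-suc zero    (suc k) = refl
  repunit-suc (suc L) zero    = refl
  repunit-suc (suc L) (suc k) = repunit-suc L k

  -- (X − 1)(1 + X + ⋯ + X^(L−1)) = X^L − 1, with both sides moved so that no subtraction occurs.
  repunit-telescope : ∀ L k → (X· repunit L ⊕ one) k ≡ (repunit L ⊕ X^ L · one) k
  repunit-telescope zero    zero    = refl
  repunit-telescope zero    (suc k) = refl
  repunit-telescope (suc L) zero    = refl
  repunit-telescope (suc L) (suc k) = trans (+-identityʳ _) (repunit-suc L k)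


module Congruence (m : ℕ) .{{_ : NonZero m}} where

  open import Data.Nat
  open import Data.Nat.Properties
  open import Data.Nat.DivMod
  open import Data.Nat.Divisibility using (_∣_; m%n≡0⇒n∣m; n∣m⇒m%n≡0)
  open import Data.Nat.Primality using (Prime; euclidsLemma)
  open import Data.Sum using (inj₁; inj₂; [_,_]′)
  open import Level using (0ℓ)
  open import Relation.Binary.Bundles using (Setoid)
  open import Relation.Binary.PropositionalEquality
  open import Relation.Nullary using (¬_; contradiction)

  -- A record rather than x % m ≡ y % m, so that x and y can be inferred from a proof.
  infix 4 _≡ₘ_
  record _≡ₘ_ (x y : ℕ) : Set where
    constructor %-≡⇒≡ₘ
    field ≡ₘ⇒%-≡ : x % m ≡ y % m
  open _≡ₘ_ public

  ≡ₘ-refl : ∀ {x} → x ≡ₘ x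
  ≡ₘ-refl = %-≡⇒≡ₘ refl

  ≡ₘ-sym : ∀ {x y} → x ≡ₘ y → y ≡ₘ x
  ≡ₘ-sym (%-≡⇒≡ₘ eq) = %-≡⇒≡ₘ (sym eq)

  ≡ₘ-trans : ∀ {x y z} → x ≡ₘ y → y ≡ₘ z → x ≡ₘ z
  ≡ₘ-trans (%-≡⇒≡ₘ p) (%-≡⇒≡ₘ q) = %-≡⇒≡ₘ (trans p q)

  ≡⇒≡ₘ : ∀ {x y} → x ≡ y → x ≡ₘ y
  ≡⇒≡ₘ refl = ≡ₘ-refl

  ≡ₘ-setoid : Setoid 0ℓ 0ℓ
  ≡ₘ-setoid = record
    { Carrier = ℕ
    ; _≈_ = _≡ₘ_
    ; isEquivalence = record { refl = ≡ₘ-refl ; sym = ≡ₘ-sym ; trans = ≡ₘ-trans }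
    }

  module ≡ₘ-Reasoning where
    open import Relation.Binary.Reasoning.Setoid ≡ₘ-setoid public

  +-congₘ : ∀ {x x′ y y′} → x ≡ₘ x′ → y ≡ₘ y′ → x + y ≡ₘ x′ + y′
  +-congₘ {x} {x′} {y} {y′} (%-≡⇒≡ₘ p) (%-≡⇒≡ₘ q) = %-≡⇒≡ₘ (begin
    (x + y) % m              ≡⟨ %-distribˡ-+ x y m ⟩
    (x % m + y % m) % m      ≡⟨ cong₂ (λ u v → (u + v) % m) p q ⟩
    (x′ % m + y′ % m) % m    ≡⟨ %-distribˡ-+ x′ y′ m ⟨
    (x′ + y′) % m            ∎)
    where open ≡-Reasoning

  *-congₘ : ∀ {x x′ y y′} → x ≡ₘ x′ → y ≡ₘ y′ → x * y ≡ₘ x′ * y′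
  *-congₘ {x} {x′} {y} {y′} (%-≡⇒≡ₘ p) (%-≡⇒≡ₘ q) = %-≡⇒≡ₘ (begin
    (x * y) % m              ≡⟨ %-distribˡ-* x y m ⟩
    (x % m * (y % m)) % m    ≡⟨ cong₂ (λ u v → (u * v) % m) p q ⟩
    (x′ % m * (y′ % m)) % m  ≡⟨ %-distribˡ-* x′ y′ m ⟨
    (x′ * y′) % m            ∎)
    where open ≡-Reasoning

  0%m≡0 : 0 % m ≡ 0
  0%m≡0 = m<n⇒m%n≡m (>-nonZero⁻¹ m)

  %-≡ₘ : ∀ x → x % m ≡ₘ x
  %-≡ₘ x = %-≡⇒≡ₘ (m%n%n≡m%n x m)

  *m-≡ₘ0 : ∀ k → k * m ≡ₘ 0
  *m-≡ₘ0 k = %-≡⇒≡ₘ (trans (m*n%n≡0 k m) (sym 0%m≡0))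

  ≡ₘ⇒≡ : ∀ {x y} → x < m → y < m → x ≡ₘ y → x ≡ y
  ≡ₘ⇒≡ {x} {y} x<m y<m (%-≡⇒≡ₘ eq) = trans (sym (m<n⇒m%n≡m x<m)) (trans eq (m<n⇒m%n≡m y<m))

  sumℕ-congₘ : ∀ L {f g : ℕ → ℕ} → (∀ i → i < L → f i ≡ₘ g i) → sumℕ L f ≡ₘ sumℕ L g
  sumℕ-congₘ zero    f≡g = ≡ₘ-refl
  sumℕ-congₘ (suc L) f≡g = +-congₘ (sumℕ-congₘ L (λ i i<L → f≡g i (m<n⇒m<1+n i<L))) (f≡g L ≤-refl)

  +-cancelʳ-≡ₘ : ∀ x y c → x + c ≡ₘ y + c → x ≡ₘ y
  +-cancelʳ-≡ₘ x y c x+c≡y+c = begin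
    x                  ≡⟨ +-identityʳ x ⟨
    x + 0              ≈⟨ +-congₘ (≡ₘ-refl {x}) (*m-≡ₘ0 c) ⟨
    x + c * m          ≡⟨ split x ⟩
    x + c + c * pred m ≈⟨ +-congₘ x+c≡y+c ≡ₘ-refl ⟩
    y + c + c * pred m ≡⟨ split y ⟨
    y + c * m          ≈⟨ +-congₘ (≡ₘ-refl {y}) (*m-≡ₘ0 c) ⟩
    y + 0              ≡⟨ +-identityʳ y ⟩
    y                  ∎
    where
    open ≡ₘ-Reasoning
    split : ∀ z → z + c * m ≡ z + c + c * pred m
    split z = trans (cong (λ n → z + c * n) (sym (suc-pred m))) (trans (cong (z +_) (*-suc c (pred m))) (sym (+-assoc z c _)))

  ≡ₘ0⇒∣ : ∀ {x} → x ≡ₘ 0 → m ∣ x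
  ≡ₘ0⇒∣ {x} (%-≡⇒≡ₘ eq) = m%n≡0⇒n∣m x m (trans eq 0%m≡0)

  ∣⇒≡ₘ0 : ∀ {x} → m ∣ x → x ≡ₘ 0
  ∣⇒≡ₘ0 {x} m∣x = %-≡⇒≡ₘ (trans (n∣m⇒m%n≡0 x m m∣x) (sym 0%m≡0))

  ∣∸⇒≡ₘ : ∀ {x y} → y ≤ x → m ∣ x ∸ y → x ≡ₘ y
  ∣∸⇒≡ₘ {x} {y} y≤x m∣x∸y = ≡ₘ-trans (≡⇒≡ₘ (sym (m∸n+n≡m y≤x))) (+-congₘ (∣⇒≡ₘ0 m∣x∸y) (≡ₘ-refl {y}))

  ≡ₘ⇒∣∸ : ∀ {x y} → y ≤ x → x ≡ₘ y → m ∣ x ∸ y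
  ≡ₘ⇒∣∸ {x} {y} y≤x x≡y = ≡ₘ0⇒∣ (+-cancelʳ-≡ₘ (x ∸ y) 0 y (≡ₘ-trans (≡⇒≡ₘ (m∸n+n≡m y≤x)) x≡y))

  *-cancelˡ-≡ₘ : Prime m → ∀ {c x y} → ¬ (m ∣ c) → c * x ≡ₘ c * y → x ≡ₘ y
  *-cancelˡ-≡ₘ pr {c} {x} {y} m∤c cx≡cy =
    [ (λ y≤x → cancel y≤x cx≡cy) , (λ x≤y → ≡ₘ-sym (cancel x≤y (≡ₘ-sym cx≡cy))) ]′ (≤-total y x)
    where
    cancel : ∀ {x y} → y ≤ x → c * x ≡ₘ c * y → x ≡ₘ y
    cancel {x} {y} y≤x cx≡cy with euclidsLemma c (x ∸ y) pr
      (subst (m ∣_) (sym (*-distribˡ-∸ c x y)) (≡ₘ⇒∣∸ (*-monoʳ-≤ c y≤x) cx≡cy))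
    ... | inj₁ m∣c   = contradiction m∣c m∤c
    ... | inj₂ m∣x∸y = ∣∸⇒≡ₘ y≤x m∣x∸y


module PascalMatrix where

  open import Data.Nat
  open import Data.Nat.Properties
  open import Data.Nat.Combinatorics using (_C_; nCn≡1; k>n⇒nCk≡0)
  open import Data.Nat.Divisibility using (_∣_)
  open import Level using (0ℓ)
  open import Relation.Binary.Bundles using (Setoid)
  open import Relation.Binary.PropositionalEquality
  open import Relation.Binary.Definitions using (tri<; tri≈; tri>)
  open import Relation.Nullary using (yes; no)
  open FiniteSums
  open Polynomials

  BinomialsDivisible : ℕ → ℕ → Set
  BinomialsDivisible b R = ∀ i → 0 < i → i < R → b ∣ R C i

  binomialsDivisible-1 : ∀ b → BinomialsDivisible b 1
  binomialsDivisible-1 b (suc i) _ (s≤s ())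

  module CoeffCongruence (m : ℕ) .{{_ : NonZero m}} where

    open Congruence m

    infix 4 _≈_
    _≈_ : Coeffs → Coeffs → Set
    f ≈ g = ∀ k → f k ≡ₘ g k

    ≡⇒≈ : ∀ {f g} → (∀ k → f k ≡ g k) → f ≈ g
    ≡⇒≈ f≡g k = ≡⇒≡ₘ (f≡g k)

    ≈-setoid : Setoid 0ℓ 0ℓ
    ≈-setoid = record
      { Carrier = Coeffs
      ; _≈_ = _≈_
      ; isEquivalence = record
        { refl = λ _ → ≡ₘ-refl
        ; sym = λ f≈g k → ≡ₘ-sym (f≈g k)
        ; trans = λ f≈g g≈h k → ≡ₘ-trans (f≈g k) (g≈h k)
        }
      }

    module ≈-Reasoning where
      open import Relation.Binary.Reasoning.Setoid ≈-setoid public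

    open Setoid ≈-setoid public using () renaming (refl to ≈-refl; sym to ≈-sym; trans to ≈-trans)

    ⊕-cong : ∀ {f f′ g g′} → f ≈ f′ → g ≈ g′ → f ⊕ g ≈ f′ ⊕ g′
    ⊕-cong f≈f′ g≈g′ k = +-congₘ (f≈f′ k) (g≈g′ k)

    ⊙-cong : ∀ c {f f′} → f ≈ f′ → c ⊙ f ≈ c ⊙ f′
    ⊙-cong c f≈f′ k = *-congₘ (≡ₘ-refl {c}) (f≈f′ k)

    X·-congₘ : ∀ {f g} → f ≈ g → X· f ≈ X· g
    X·-congₘ f≈g zero    = ≡ₘ-refl
    X·-congₘ f≈g (suc k) = f≈g k

    X^·-cong : ∀ n {f g} → f ≈ g → X^ n · f ≈ X^ n · g
    X^·-cong zero    f≈g = f≈g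
    X^·-cong (suc n) f≈g = X·-congₘ (X^·-cong n f≈g)

    binomial≡ₘindicator : ∀ {R} → 0 < R → BinomialsDivisible m R → ∀ i → R C i ≡ₘ indicator 0 i + indicator R i
    binomial≡ₘindicator {R} 0<R div zero = ≡⇒≡ₘ (cong (1 +_) (sym (indicator-≢ R 0 (>⇒≢ 0<R))))
    binomial≡ₘindicator {R} 0<R div (suc i) with <-cmp (suc i) R
    ... | tri< i<R _ _  = ≡ₘ-trans (∣⇒≡ₘ0 (div (suc i) z<s i<R)) (≡⇒≡ₘ (sym (indicator-≢ R (suc i) (>⇒≢ i<R))))
    ... | tri≈ _ refl _ = ≡⇒≡ₘ (trans (nCn≡1 (suc i)) (sym (indicator-refl (suc i))))
    ... | tri> _ _ R<i  = ≡⇒≡ₘ (trans (k>n⇒nCk≡0 R<i) (sym (indicator-≢ R (suc i) (<⇒≢ R<i))))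

    [1+X]^-frobenius : ∀ {R} → 0 < R → BinomialsDivisible m R → ∀ h → [1+X]^ R · h ≈ X^ R · h ⊕ h
    [1+X]^-frobenius {R} 0<R div h k = begin
      ([1+X]^ R · h) k
        ≈⟨ sumℕ-congₘ (suc k) (λ i _ → *-congₘ (binomial≡ₘindicator 0<R div i) (≡ₘ-refl {h (k ∸ i)})) ⟩
      sumℕ (suc k) (λ i → (indicator 0 i + indicator R i) * h (k ∸ i))
        ≡⟨ trans (sumℕ-cong (suc k) (λ i _ → *-distribʳ-+ (h (k ∸ i)) (indicator 0 i) (indicator R i))) (sumℕ-+ (suc k) _ _) ⟩
      sumℕ (suc k) (λ i → indicator 0 i * h (k ∸ i)) + sumℕ (suc k) (λ i → indicator R i * h (k ∸ i))
        ≡⟨ cong₂ _+_ (sumℕ-indicator-in 0 (suc k) (λ i → h (k ∸ i)) z<s) shifted ⟩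
      h k + (X^ R · h) k
        ≡⟨ +-comm (h k) _ ⟩
      (X^ R · h) k + h k ∎
      where
      open ≡ₘ-Reasoning
      shifted : sumℕ (suc k) (λ i → indicator R i * h (k ∸ i)) ≡ (X^ R · h) k
      shifted with R ≤? k
      ... | yes R≤k = trans (sumℕ-indicator-in R (suc k) (λ i → h (k ∸ i)) (s≤s R≤k))
                            (trans (sym (X^·-at R h (k ∸ R))) (cong (X^ R · h) (m+[n∸m]≡n R≤k)))
      ... | no R≰k  = trans (sumℕ-indicator-out R (suc k) (λ i → h (k ∸ i)) (≰⇒> R≰k))
                            (sym (X^·-below R h k (≰⇒> R≰k)))

  module Pascal (b : ℕ) .{{_ : NonZero b}} (T : ℕ) where

    open Congruence b
    open CoeffCongruence b

    P : Coeffs → Coeffs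
    P = applyP b (suc T)

    infixr 7 P^_·_
    P^_·_ : ℕ → Coeffs → Coeffs
    P^ j · f = powP b (suc T) j f

    P≈pascalSum : ∀ f → P f ≈ pascalSum (suc T) f
    P≈pascalSum f k = %-≡ₘ (pascalSum (suc T) f k)

    P-cong : ∀ {f g} → f ≈ g → P f ≈ P g
    P-cong {f} {g} f≈g k = begin
      P f k                    ≈⟨ P≈pascalSum f k ⟩
      pascalSum (suc T) f k    ≈⟨ sumℕ-congₘ (suc T) (λ i _ → *-congₘ (≡ₘ-refl {i C k}) (f≈g i)) ⟩
      pascalSum (suc T) g k    ≈⟨ P≈pascalSum g k ⟨
      P g k                    ∎
      where open ≡ₘ-Reasoning

    P^-cong : ∀ j {f g} → f ≈ g → P^ j · f ≈ P^ j · g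
    P^-cong zero    f≈g = f≈g
    P^-cong (suc j) f≈g = P-cong (P^-cong j f≈g)

    P-⊕ : ∀ f g → P (f ⊕ g) ≈ P f ⊕ P g
    P-⊕ f g k = begin
      P (f ⊕ g) k                                    ≈⟨ P≈pascalSum (f ⊕ g) k ⟩
      pascalSum (suc T) (f ⊕ g) k                    ≡⟨ pascalSum-⊕ (suc T) f g k ⟩
      pascalSum (suc T) f k + pascalSum (suc T) g k  ≈⟨ ⊕-cong (P≈pascalSum f) (P≈pascalSum g) k ⟨
      P f k + P g k                                  ∎
      where open ≡ₘ-Reasoning

    P-⊙ : ∀ c f → P (c ⊙ f) ≈ c ⊙ P f
    P-⊙ c f k = begin
      P (c ⊙ f) k                    ≈⟨ P≈pascalSum (c ⊙ f) k ⟩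
      pascalSum (suc T) (c ⊙ f) k    ≡⟨ pascalSum-⊙ (suc T) c f k ⟩
      c * pascalSum (suc T) f k      ≈⟨ ⊙-cong c (P≈pascalSum f) k ⟨
      c * P f k                      ∎
      where open ≡ₘ-Reasoning

    P^-⊕ : ∀ j f g → P^ j · (f ⊕ g) ≈ P^ j · f ⊕ P^ j · g
    P^-⊕ zero    f g = ≈-refl
    P^-⊕ (suc j) f g = ≈-trans (P-cong (P^-⊕ j f g)) (P-⊕ (P^ j · f) (P^ j · g))

    P-degree : ∀ {S f} → DegreeBelow S f → DegreeBelow S (P f)
    P-degree deg k S≤k = trans (cong (_% b) (pascalSum-degree (suc T) deg k S≤k)) 0%m≡0

    P^-degree : ∀ j {S f} → DegreeBelow S f → DegreeBelow S (P^ j · f)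
    P^-degree zero    deg = deg
    P^-degree (suc j) deg = P-degree (P^-degree j deg)

    P^-one : ∀ j → P^ j · one ≈ one
    P^-one zero    = ≈-refl
    P^-one (suc j) = ≈-trans (P-cong (P^-one j)) (λ k → ≡ₘ-trans (P≈pascalSum one k) (≡⇒≡ₘ (pascalSum-one T k)))

    P-X^· : ∀ {R} → 0 < R → BinomialsDivisible b R → ∀ {S g} → DegreeBelow S g → S + R ≤ T →
            P (X^ R · g) ≈ X^ R · P g ⊕ P g
    P-X^· {R} 0<R div {g = g} deg S+R≤T k = begin
      P (X^ R · g) k                                          ≈⟨ P≈pascalSum (X^ R · g) k ⟩
      pascalSum (suc T) (X^ R · g) k                          ≡⟨ pascalSum-X^· T R deg S+R≤T k ⟩
      ([1+X]^ R · pascalSum (suc T) g) k                      ≈⟨ [1+X]^-frobenius 0<R div _ k ⟩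
      (X^ R · pascalSum (suc T) g) k + pascalSum (suc T) g k  ≈⟨ ⊕-cong (X^·-cong R (P≈pascalSum g)) (P≈pascalSum g) k ⟨
      (X^ R · P g) k + P g k                                  ∎
      where open ≡ₘ-Reasoning

    -- P^j is the substitution X ↦ X + j, and for R a power of b, (X + j)^R = X^R + j.
    P^-X^· : ∀ {R} → 0 < R → BinomialsDivisible b R → ∀ {S g} → DegreeBelow S g → S + R ≤ T →
             ∀ j → P^ j · X^ R · g ≈ X^ R · P^ j · g ⊕ j ⊙ P^ j · g
    P^-X^· 0<R div deg S+R≤T zero    k = ≡⇒≡ₘ (sym (+-identityʳ _))
    P^-X^· {R} 0<R div {g = g} deg S+R≤T (suc j) = begin
      P (P^ j · X^ R · g)                    ≈⟨ P-cong (P^-X^· 0<R div deg S+R≤T j) ⟩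
      P (X^ R · h ⊕ j ⊙ h)                   ≈⟨ P-⊕ (X^ R · h) (j ⊙ h) ⟩
      P (X^ R · h) ⊕ P (j ⊙ h)               ≈⟨ ⊕-cong (P-X^· 0<R div (P^-degree j deg) S+R≤T) (P-⊙ j h) ⟩
      X^ R · P h ⊕ P h ⊕ j ⊙ P h             ≈⟨ ≡⇒≈ (λ k → +-assoc ((X^ R · P h) k) (P h k) (j * P h k)) ⟩
      X^ R · P h ⊕ suc j ⊙ P h               ∎
      where
      open ≈-Reasoning
      h = P^ j · g


module PrimePowerBinomials where

  open import Data.Nat
  open import Data.Nat.Properties
  open import Data.Nat.Combinatorics using (_C_; nC1≡n; nCk+nC[k+1]≡[n+1]C[k+1])
  open import Data.Nat.Divisibility using (_∣_; divides; ∣-trans; ∣-refl; m∣m*n; ∣m⇒∣m*n; *-cancelˡ-∣)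
  open import Data.Nat.Primality using (Prime; euclidsLemma; prime⇒nonZero)
  open import Data.Nat.Tactic.RingSolver using (solve-∀)
  open import Data.Sum using (inj₁; inj₂)
  open import Relation.Binary.PropositionalEquality
  open import Relation.Nullary using (contradiction)
  open PascalMatrix

  [1+i]*[1+n]C[1+i]≡[1+n]*nCi : ∀ n i → suc i * (suc n C suc i) ≡ suc n * (n C i)
  [1+i]*[1+n]C[1+i]≡[1+n]*nCi zero    zero    = refl
  [1+i]*[1+n]C[1+i]≡[1+n]*nCi zero    (suc i) = *-zeroʳ (suc (suc i))
  [1+i]*[1+n]C[1+i]≡[1+n]*nCi (suc n) zero    = trans (*-identityˡ _) (trans (nC1≡n (suc (suc n))) (sym (*-identityʳ (suc (suc n)))))
  [1+i]*[1+n]C[1+i]≡[1+n]*nCi (suc n) (suc i) = begin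
    suc (suc i) * (suc (suc n) C suc (suc i)) ≡⟨ cong (suc (suc i) *_) (nCk+nC[k+1]≡[n+1]C[k+1] (suc n) (suc i)) ⟨
    suc (suc i) * (c + d)                     ≡⟨ rearrange i c d ⟩
    c + (suc i * c + suc (suc i) * d)         ≡⟨ cong₂ (λ u v → c + (u + v)) ([1+i]*[1+n]C[1+i]≡[1+n]*nCi n i) ([1+i]*[1+n]C[1+i]≡[1+n]*nCi n (suc i)) ⟩
    c + (suc n * (n C i) + suc n * (n C suc i)) ≡⟨ cong (c +_) (*-distribˡ-+ (suc n) (n C i) (n C suc i)) ⟨
    c + suc n * (n C i + n C suc i)           ≡⟨ cong (λ u → c + suc n * u) (nCk+nC[k+1]≡[n+1]C[k+1] n i) ⟩
    c + suc n * c                             ∎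
    where
    open ≡-Reasoning
    c = suc n C suc i
    d = suc n C suc (suc i)
    rearrange : ∀ i c d → suc (suc i) * (c + d) ≡ c + (suc i * c + suc (suc i) * d)
    rearrange = solve-∀

  module _ {p : ℕ} (pr : Prime p) where

    private instance
      p-nonZero : NonZero p
      p-nonZero = prime⇒nonZero pr

    p^r∣i*c⇒p∣c : ∀ r {i c} → 0 < i → i < p ^ r → p ^ r ∣ i * c → p ∣ c
    p^r∣i*c⇒p∣c zero    0<i i<1 _ = contradiction 0<i (≤⇒≯ (≤-pred i<1))
    p^r∣i*c⇒p∣c (suc r) {i} {c} 0<i i<p^[1+r] p^[1+r]∣ic with euclidsLemma i c pr (∣-trans (m∣m*n (p ^ r)) p^[1+r]∣ic)
    ... | inj₂ p∣c = p∣c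
    ... | inj₁ (divides i′ refl) = p^r∣i*c⇒p∣c r 0<i′ i′<p^r p^r∣i′c
      where
      i′p≡pi′ : i′ * p ≡ p * i′
      i′p≡pi′ = *-comm i′ p
      0<i′ : 0 < i′
      0<i′ = >-nonZero⁻¹ i′ {{m*n≢0⇒m≢0 i′ {{>-nonZero 0<i}}}}
      i′<p^r : i′ < p ^ r
      i′<p^r = *-cancelˡ-< p i′ (p ^ r) (subst (_< p * p ^ r) i′p≡pi′ i<p^[1+r])
      p^r∣i′c : p ^ r ∣ i′ * c
      p^r∣i′c = *-cancelˡ-∣ p (subst (p * p ^ r ∣_) (trans (cong (_* c) i′p≡pi′) (*-assoc p i′ c)) p^[1+r]∣ic)

    prime-binomialsDivisible : ∀ r → BinomialsDivisible p (p ^ r)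
    prime-binomialsDivisible r (suc i) 0<i i<R =
      p^r∣i*c⇒p∣c r 0<i i<R (subst (R ∣_) (sym absorption) (∣m⇒∣m*n _ ∣-refl))
      where
      R = p ^ r
      R≡1+R-1 : R ≡ suc (pred R)
      R≡1+R-1 = sym (suc-pred R {{m^n≢0 p r}})
      absorption : suc i * (R C suc i) ≡ R * (pred R C i)
      absorption = begin
        suc i * (R C suc i)            ≡⟨ cong (λ n → suc i * (n C suc i)) R≡1+R-1 ⟩
        suc i * (suc (pred R) C suc i) ≡⟨ [1+i]*[1+n]C[1+i]≡[1+n]*nCi (pred R) i ⟩
        suc (pred R) * (pred R C i)    ≡⟨ cong (_* (pred R C i)) R≡1+R-1 ⟨
        R * (pred R C i)               ∎
        where open ≡-Reasoning


module Fermat {b : ℕ} (pr : Prime b) where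

  open import Data.Nat
  open import Data.Nat.Properties
  open import Data.Nat.Divisibility using (_∣_)
  open import Data.Nat.Primality using (Prime; prime⇒nonZero)
  open import Relation.Binary.PropositionalEquality
  open import Relation.Nullary using (¬_)
  open Polynomials
  open PascalMatrix
  open PrimePowerBinomials

  private instance
    b-nonZero : NonZero b
    b-nonZero = prime⇒nonZero pr

  open Congruence b
  open CoeffCongruence b
  open Pascal b (suc b)

  infixr 7 [X+_]^_
  [X+_]^_ : ℕ → ℕ → Coeffs
  [X+ j ]^ zero  = one
  [X+ j ]^ suc m = X· [X+ j ]^ m ⊕ j ⊙ [X+ j ]^ m

  [X+j]^m-at0 : ∀ j m → ([X+ j ]^ m) 0 ≡ j ^ m
  [X+j]^m-at0 j zero    = refl
  [X+j]^m-at0 j (suc m) = cong (j *_) ([X+j]^m-at0 j m)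

  P^j·X^m·one : ∀ j m → m ≤ b → P^ j · X^ m · one ≈ [X+ j ]^ m
  P^j·X^m·one j zero    _     = P^-one j
  P^j·X^m·one j (suc m) m<b = ≈-trans
    (P^-X^· z<s (binomialsDivisible-1 b) (X^·-degree m one-degree) m+1+1≤1+b j)
    (⊕-cong (X·-congₘ ih) (⊙-cong j ih))
    where
    ih = P^j·X^m·one j m (<⇒≤ m<b)
    m+1+1≤1+b : m + 1 + 1 ≤ suc b
    m+1+1≤1+b = subst (_≤ suc b) (trans (cong suc (+-comm 1 m)) (+-comm 1 (m + 1))) (s≤s m<b)

  -- Compare the constant coefficients of P^j X^b computed one power of X at a time and all at once.
  fermat : ∀ j → j ^ b ≡ₘ j
  fermat j = begin
    j ^ b                                          ≡⟨ [X+j]^m-at0 j b ⟨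
    ([X+ j ]^ b) 0                                 ≈⟨ P^j·X^m·one j b ≤-refl 0 ⟨
    (P^ j · X^ b · one) 0                          ≈⟨ P^-X^· 0<b rowb one-degree ≤-refl j 0 ⟩
    (X^ b · P^ j · one) 0 + j * (P^ j · one) 0     ≡⟨ cong (_+ j * (P^ j · one) 0) (X^·-below b (P^ j · one) 0 0<b) ⟩
    j * (P^ j · one) 0                             ≈⟨ *-congₘ (≡ₘ-refl {j}) (P^-one j 0) ⟩
    j * 1                                          ≡⟨ *-identityʳ j ⟩
    j                                              ∎
    where
    open ≡ₘ-Reasoning
    0<b : 0 < b
    0<b = >-nonZero⁻¹ b
    rowb : BinomialsDivisible b b
    rowb = subst (BinomialsDivisible b) (*-identityʳ b) (prime-binomialsDivisible pr 1)

  fermat-unit : ∀ {j} → ¬ (b ∣ j) → j ^ (b ∸ 1) ≡ₘ 1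
  fermat-unit {j} b∤j = *-cancelˡ-≡ₘ pr b∤j (begin
    j * j ^ (b ∸ 1)   ≡⟨ cong (j ^_) (suc-pred b) ⟩
    j ^ b             ≈⟨ fermat j ⟩
    j                 ≡⟨ *-identityʳ j ⟨
    j * 1             ∎)
    where open ≡ₘ-Reasoning


module RepunitsUnderPascal where

  open import Data.Nat
  open import Data.Nat.Properties
  open import Data.Nat.DivMod using (m%n<n)
  open import Data.Nat.Tactic.RingSolver using (solve-∀)
  open import Data.Nat.Divisibility using (_∣_; ∣⇒≤)
  open import Data.Nat.Primality using (Prime; prime⇒nonZero; prime⇒nonTrivial)
  open import Relation.Binary.PropositionalEquality
  open import Relation.Nullary using (¬_)
  open Polynomials
  open PascalMatrix
  open PrimePowerBinomials

  module _ {b : ℕ} (pr : Prime b) where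

    private instance
      b-nonZero : NonZero b
      b-nonZero = prime⇒nonZero pr

    open Congruence b

    shift-recurrence⇒zero : ∀ {R c w} → c < b → (∀ k → k < R → (X· w) k + c * w k ≡ₘ 0) →
                            ∀ k → suc k < R → w k ≡ₘ 0
    shift-recurrence⇒zero {c = zero} c<b rec k 1+k<R = ≡ₘ-trans (≡⇒≡ₘ (sym (+-identityʳ _))) (rec (suc k) 1+k<R)
    shift-recurrence⇒zero {R} {suc c} {w} c<b rec k 1+k<R = below-R k (<⇒≤ 1+k<R)
      where
      b∤c : ¬ (b ∣ suc c)
      b∤c b∣c = <⇒≱ c<b (∣⇒≤ b∣c)
      below-R : ∀ k → k < R → w k ≡ₘ 0
      below-R zero    0<R   = *-cancelˡ-≡ₘ pr b∤c (≡ₘ-trans (rec 0 0<R) (≡⇒≡ₘ (sym (*-zeroʳ (suc c)))))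
      below-R (suc k) 1+k<R = *-cancelˡ-≡ₘ pr b∤c (begin
        suc c * w (suc k)         ≈⟨ +-congₘ (below-R k (<⇒≤ 1+k<R)) (≡ₘ-refl {suc c * w (suc k)}) ⟨
        w k + suc c * w (suc k)   ≈⟨ rec (suc k) 1+k<R ⟩
        0                         ≡⟨ *-zeroʳ (suc c) ⟨
        suc c * 0                 ∎)
        where open ≡ₘ-Reasoning

  module PascalPowerOfRepunit {b : ℕ} (pr : Prime b) (r : ℕ) {T : ℕ} (L<T : (b ∸ 1) * b ^ r < T)
                              {j : ℕ} (0<j : 0 < j) (j<b : j < b) where

    private instance
      b-nonZero : NonZero b
      b-nonZero = prime⇒nonZero pr

    open Congruence b
    open CoeffCongruence b
    open Pascal b T
    open Fermat pr using (fermat-unit)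

    R L : ℕ
    R = b ^ r
    L = (b ∸ 1) * R

    [X^R+j]^_ : ℕ → Coeffs
    [X^R+j]^ zero  = one
    [X^R+j]^ suc m = X^ R · [X^R+j]^ m ⊕ j ⊙ [X^R+j]^ m

    [X^R+j]^-low : ∀ m k → k < R → ([X^R+j]^ m) k ≡ j ^ m * one k
    [X^R+j]^-low zero    k _   = sym (+-identityʳ (one k))
    [X^R+j]^-low (suc m) k k<R = begin
      (X^ R · [X^R+j]^ m) k + j * ([X^R+j]^ m) k ≡⟨ cong₂ _+_ (X^·-below R _ k k<R) (cong (j *_) ([X^R+j]^-low m k k<R)) ⟩
      j * (j ^ m * one k)                       ≡⟨ *-assoc j (j ^ m) (one k) ⟨
      j ^ suc m * one k                         ∎
      where open ≡-Reasoning

    mR+1+R≤T : ∀ m → suc m ≤ b ∸ 1 → m * R + 1 + R ≤ T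
    mR+1+R≤T m 1+m≤b-1 = begin
      m * R + 1 + R     ≡⟨ rearrange m R ⟩
      suc (suc m * R)   ≤⟨ s≤s (*-monoˡ-≤ R 1+m≤b-1) ⟩
      suc L             ≤⟨ L<T ⟩
      T                 ∎
      where
      open ≤-Reasoning
      rearrange : ∀ m R → m * R + 1 + R ≡ suc (R + m * R)
      rearrange = solve-∀

    P^j·X^[mR]·one : ∀ m → m ≤ b ∸ 1 → P^ j · X^ (m * R) · one ≈ [X^R+j]^ m
    P^j·X^[mR]·one zero    _       = P^-one j
    P^j·X^[mR]·one (suc m) 1+m≤b-1 = begin
      P^ j · X^ (R + m * R) · one    ≡⟨ cong (P^ j ·_) (X^-+· R (m * R) one) ⟩
      P^ j · X^ R · X^ (m * R) · one
        ≈⟨ P^-X^· (m^n>0 b r) (prime-binomialsDivisible pr r) (X^·-degree (m * R) one-degree) (mR+1+R≤T m 1+m≤b-1) j ⟩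
      X^ R · P^ j · X^ (m * R) · one ⊕ j ⊙ P^ j · X^ (m * R) · one
        ≈⟨ ⊕-cong (X^·-cong R ih) (⊙-cong j ih) ⟩
      [X^R+j]^ suc m                 ∎
      where
      open ≈-Reasoning
      ih = P^j·X^[mR]·one m (<⇒≤ 1+m≤b-1)

    b∤j : ¬ (b ∣ j)
    b∤j b∣j = <⇒≱ j<b (∣⇒≤ ⦃ >-nonZero 0<j ⦄ b∣j)

    P^j·X^L·one-low : ∀ k → k < R → (P^ j · X^ L · one) k ≡ₘ one k
    P^j·X^L·one-low k k<R = begin
      (P^ j · X^ L · one) k   ≈⟨ P^j·X^[mR]·one (b ∸ 1) ≤-refl k ⟩
      ([X^R+j]^ (b ∸ 1)) k    ≡⟨ [X^R+j]^-low (b ∸ 1) k k<R ⟩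
      j ^ (b ∸ 1) * one k     ≈⟨ *-congₘ (fermat-unit b∤j) (≡ₘ-refl {one k}) ⟩
      1 * one k               ≡⟨ *-identityˡ (one k) ⟩
      one k                   ∎
      where open ≡ₘ-Reasoning

    private
      w : Coeffs
      w = P^ j · repunit L

    L+1≤T : L + 1 ≤ T
    L+1≤T = ≤-trans (≤-reflexive (+-comm L 1)) L<T

    -- P^j applied to the telescoping identity: ((X + j) − 1) w = (X + j)^L − 1, which vanishes below X^R.
    P^j·repunit-recurrence : ∀ k → k < R → (X· w) k + pred j * w k ≡ₘ 0
    P^j·repunit-recurrence k k<R = +-cancelʳ-≡ₘ _ 0 (w k) (begin
      (X· w) k + pred j * w k + w k         ≡⟨ rearrange ((X· w) k) (pred j * w k) (w k) ⟩
      (X· w) k + suc (pred j) * w k         ≡⟨ cong (λ c → (X· w) k + c * w k) (suc-pred j ⦃ >-nonZero 0<j ⦄) ⟩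
      (X· w) k + j * w k                    ≡⟨ +-identityʳ _ ⟨
      (X· w) k + j * w k + 0                ≈⟨ +-cancelʳ-≡ₘ _ _ (one k) telescoped ⟩
      w k                                   ∎)
      where
      open ≡ₘ-Reasoning
      rearrange : ∀ x y z → x + y + z ≡ x + (z + y)
      rearrange = solve-∀
      telescoped : (X· w) k + j * w k + 0 + one k ≡ₘ w k + one k
      telescoped = begin
        (X· w) k + j * w k + 0 + one k          ≡⟨ cong (_+ one k) (+-identityʳ _) ⟩
        (X· w) k + j * w k + one k              ≈⟨ ⊕-cong (P^-X^· z<s (binomialsDivisible-1 b) (repunit-degree L) L+1≤T j) (P^-one j) k ⟨
        (P^ j · X· repunit L) k + (P^ j · one) k ≈⟨ P^-⊕ j (X· repunit L) one k ⟨
        (P^ j · (X· repunit L ⊕ one)) k          ≈⟨ P^-cong j (≡⇒≈ (repunit-telescope L)) k ⟩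
        (P^ j · (repunit L ⊕ X^ L · one)) k      ≈⟨ P^-⊕ j (repunit L) (X^ L · one) k ⟩
        w k + (P^ j · X^ L · one) k              ≈⟨ +-congₘ (≡ₘ-refl {w k}) (P^j·X^L·one-low k k<R) ⟩
        w k + one k                              ∎

    P^j·repunit-low : ∀ k → suc k < R → (P^ j · repunit L) k ≡ₘ 0
    P^j·repunit-low = shift-recurrence⇒zero pr (≤-<-trans pred[n]≤n j<b) P^j·repunit-recurrence

    P^j-low-digits : ∀ v → v ⊕ repunit L ≈ one → ∀ k → suc k < R → (P^ j · v) k ≡ one k
    P^j-low-digits v v+repunit≈one k 1+k<R = ≡ₘ⇒≡ P^j·v<b (one<b 1<b k) (+-cancelʳ-≡ₘ _ _ (w k) (begin
      (P^ j · v) k + w k                 ≈⟨ P^-⊕ j v (repunit L) k ⟨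
      (P^ j · (v ⊕ repunit L)) k         ≈⟨ P^-cong j v+repunit≈one k ⟩
      (P^ j · one) k                     ≈⟨ P^-one j k ⟩
      one k                              ≡⟨ +-identityʳ (one k) ⟨
      one k + 0                          ≈⟨ +-congₘ (≡ₘ-refl {one k}) (P^j·repunit-low k 1+k<R) ⟨
      one k + w k                        ∎))
      where
      open ≡ₘ-Reasoning
      P^j·v<b : (P^ j · v) k < b
      P^j·v<b rewrite sym (suc-pred j ⦃ >-nonZero 0<j ⦄) = m%n<n _ b
      1<b : 1 < b
      1<b = nonTrivial⇒n>1 b ⦃ prime⇒nonTrivial pr ⦄


module Digits {b : ℕ} .{{_ : NonZero b}} (1<b : 1 < b) where

  open import Data.Nat
  open import Data.Nat.Properties
  open import Data.Nat.DivMod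
  open import Data.Nat.Divisibility using (n∣m*n)
  open import Relation.Binary.PropositionalEquality
  open Polynomials
  open PascalMatrix

  open Congruence b
  open CoeffCongruence b

  digit-zero : ∀ k → digit b 0 k ≡ 0
  digit-zero zero    = 0%m≡0
  digit-zero (suc k) = trans (cong (λ n → digit b n k) (0/n≡0 b)) (digit-zero k)

  digit-one : ∀ k → digit b 1 k ≡ one k
  digit-one zero    = m<n⇒m%n≡m 1<b
  digit-one (suc k) = trans (cong (λ n → digit b n k) (m<n⇒m/n≡0 1<b)) (digit-zero k)

  digit-+* : ∀ {d} x → d < b → ∀ k → digit b (d + x * b) (suc k) ≡ digit b x k
  digit-+* {d} x d<b k = cong (λ n → digit b n k) (begin
    (d + x * b) / b       ≡⟨ +-distrib-/-∣ʳ d (n∣m*n x) ⟩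
    d / b + x * b / b     ≡⟨ cong₂ _+_ (m<n⇒m/n≡0 d<b) (m*n/n≡m x b) ⟩
    x                     ∎)
    where open ≡-Reasoning

  digit-+*-zero : ∀ {d} x → d < b → digit b (d + x * b) 0 ≡ d
  digit-+*-zero {d} x d<b = trans ([m+kn]%n≡m%n d x b) (m<n⇒m%n≡m d<b)

  1≤b-1 : 1 ≤ b ∸ 1
  1≤b-1 = ≤-pred (≤-trans 1<b (≤-reflexive (sym (suc-pred b))))

  b-1<b : b ∸ 1 < b
  b-1<b = ≤-reflexive (suc-pred b)

  repdigit : ℕ → ℕ
  repdigit zero    = 0
  repdigit (suc m) = (b ∸ 1) + repdigit m * b

  repdigit+1≡b^m : ∀ m → repdigit m + 1 ≡ b ^ m
  repdigit+1≡b^m zero    = refl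
  repdigit+1≡b^m (suc m) = begin
    b ∸ 1 + repdigit m * b + 1  ≡⟨ rearrange (b ∸ 1) (repdigit m * b) ⟩
    suc (b ∸ 1) + repdigit m * b ≡⟨ cong (_+ repdigit m * b) (suc-pred b) ⟩
    b + repdigit m * b          ≡⟨ *-comm (suc (repdigit m)) b ⟩
    b * suc (repdigit m)        ≡⟨ cong (b *_) (trans (+-comm 1 (repdigit m)) (repdigit+1≡b^m m)) ⟩
    b * b ^ m                   ∎
    where
    open ≡-Reasoning
    rearrange : ∀ x y → x + y + 1 ≡ suc x + y
    rearrange x y = trans (+-comm (x + y) 1) refl

  m≤repdigit : ∀ m → m ≤ repdigit m
  m≤repdigit zero    = z≤n
  m≤repdigit (suc m) = +-mono-≤ 1≤b-1 (≤-trans (m≤repdigit m) (m≤m*n (repdigit m) b))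

  digit-repdigit : ∀ m k → digit b (repdigit m) k ≡ (b ∸ 1) * repunit m k
  digit-repdigit zero    k       = trans (digit-zero k) (sym (*-zeroʳ (b ∸ 1)))
  digit-repdigit (suc m) zero    = trans (digit-+*-zero (repdigit m) b-1<b) (sym (*-identityʳ (b ∸ 1)))
  digit-repdigit (suc m) (suc k) = trans (digit-+* (repdigit m) b-1<b k) (digit-repdigit m k)

  digit-*b-zero : ∀ x → digit b (x * b) 0 ≡ 0
  digit-*b-zero x = m*n%n≡0 x b

  digit-repdigit*b : ∀ m k → digit b (repdigit m * b) (suc k) ≡ (b ∸ 1) * repunit m k
  digit-repdigit*b m k = trans (digit-+* (repdigit m) (>-nonZero⁻¹ b) k) (digit-repdigit m k)

  digit-repdigit*b+repunit≈one : ∀ m → digit b (repdigit m * b) ⊕ repunit (suc m) ≈ one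
  digit-repdigit*b+repunit≈one m zero    = ≡⇒≡ₘ (cong (_+ 1) (digit-*b-zero (repdigit m)))
  digit-repdigit*b+repunit≈one m (suc k) = begin
    digit b (repdigit m * b) (suc k) + repunit m k ≡⟨ cong (_+ repunit m k) (digit-repdigit*b m k) ⟩
    (b ∸ 1) * repunit m k + repunit m k            ≡⟨ +-comm _ (repunit m k) ⟩
    suc (b ∸ 1) * repunit m k                      ≡⟨ cong (_* repunit m k) (suc-pred b) ⟩
    b * repunit m k                                ≡⟨ *-comm b (repunit m k) ⟩
    repunit m k * b                                ≈⟨ *m-≡ₘ0 (repunit m k) ⟩
    0                                              ∎
    where open ≡ₘ-Reasoning


module Fractions where

  open import Data.Nat as ℕ using (ℕ; suc; NonZero)
  import Data.Nat.Properties as ℕ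
  open import Data.Integer as ℤ using (ℤ; +_)
  import Data.Integer.Properties as ℤ
  open import Data.Nat.Tactic.RingSolver using (solve-∀)
  open import Data.Rational as ℚ using (_/_; _+_; _-_; _*_; -_; ∣_∣; 0ℚ; ½; toℚᵘ; fromℚᵘ)
  open import Data.Rational.Properties as ℚ
  import Data.Rational.Unnormalised as ℚᵘ
  import Data.Rational.Unnormalised.Properties as ℚᵘ
  open import Data.Rational.Solver using (module +-*-Solver)
  open import Data.Product using (Σ; _,_)
  open import Data.Sum using (inj₁; inj₂)
  open import Relation.Binary.PropositionalEquality

  private
    suc-pred : ∀ d .{{_ : NonZero d}} → + suc (ℕ.pred d) ≡ + d
    suc-pred (suc d) = refl

    /≡fromℚᵘ : ∀ (a : ℤ) d .{{_ : NonZero d}} → a / d ≡ fromℚᵘ (ℚᵘ.mkℚᵘ a (ℕ.pred d))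
    /≡fromℚᵘ a (suc d) = refl

    toℚᵘ-/ : ∀ (a : ℤ) d .{{_ : NonZero d}} → toℚᵘ (a / d) ℚᵘ.≃ ℚᵘ.mkℚᵘ a (ℕ.pred d)
    toℚᵘ-/ a d = ℚᵘ.≃-trans (ℚᵘ.≃-reflexive (cong toℚᵘ (/≡fromℚᵘ a d))) (toℚᵘ-fromℚᵘ _)

    cross : ∀ a e .{{_ : NonZero e}} → + (a ℕ.* e) ≡ + a ℤ.* + suc (ℕ.pred e)
    cross a e = trans (ℤ.pos-* a e) (cong (+ a ℤ.*_) (sym (suc-pred e)))

  module _ (a c d e : ℕ) .{{_ : NonZero d}} .{{_ : NonZero e}} where

    /-≡-cross : a ℕ.* e ≡ c ℕ.* d → + a / d ≡ + c / e
    /-≡-cross eq = trans (/≡fromℚᵘ (+ a) d) (trans (fromℚᵘ-cong {ℚᵘ.mkℚᵘ (+ a) (ℕ.pred d)} {ℚᵘ.mkℚᵘ (+ c) (ℕ.pred e)} (ℚᵘ.*≡* (trans (sym (cross a e)) (trans (cong +_ eq) (cross c d)))))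
                                                  (sym (/≡fromℚᵘ (+ c) e)))

    /-≤-cross : a ℕ.* e ℕ.≤ c ℕ.* d → + a / d ℚ.≤ + c / e
    /-≤-cross le = toℚᵘ-cancel-≤ (ℚᵘ.≤-respʳ-≃ (ℚᵘ.≃-sym (toℚᵘ-/ (+ c) e)) (ℚᵘ.≤-respˡ-≃ (ℚᵘ.≃-sym (toℚᵘ-/ (+ a) d))
      (ℚᵘ.*≤* (subst₂ ℤ._≤_ (cross a e) (cross c d) (ℤ.+≤+ le)))))

    /-<-cross : a ℕ.* e ℕ.< c ℕ.* d → + a / d ℚ.< + c / e
    /-<-cross lt = toℚᵘ-cancel-< (ℚᵘ.<-respʳ-≃ (ℚᵘ.≃-sym (toℚᵘ-/ (+ c) e)) (ℚᵘ.<-respˡ-≃ (ℚᵘ.≃-sym (toℚᵘ-/ (+ a) d))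
      (ℚᵘ.*<* (subst₂ ℤ._<_ (cross a e) (cross c d) (ℤ.+<+ lt)))))

  /-+ : ∀ a c d e .{{_ : NonZero d}} .{{_ : NonZero e}} →
        + a / d + + c / e ≡ (+ (a ℕ.* e ℕ.+ c ℕ.* d) / (d ℕ.* e)) {{ℕ.m*n≢0 d e}}
  /-+ a c (suc d) (suc e) = toℚᵘ-injective (ℚᵘ.≃-trans (toℚᵘ-homo-+ (+ a / suc d) (+ c / suc e))
    (ℚᵘ.≃-trans (ℚᵘ.+-cong (toℚᵘ-/ (+ a) (suc d)) (toℚᵘ-/ (+ c) (suc e)))
    (ℚᵘ.≃-trans (ℚᵘ.*≡* (cong (ℤ._* (+ (suc d ℕ.* suc e))) numerator))
                (ℚᵘ.≃-sym (toℚᵘ-/ (+ (a ℕ.* suc e ℕ.+ c ℕ.* suc d)) (suc d ℕ.* suc e))))))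
    where
    numerator : + a ℤ.* + suc e ℤ.+ + c ℤ.* + suc d ≡ + (a ℕ.* suc e ℕ.+ c ℕ.* suc d)
    numerator = sym (trans (ℤ.pos-+ (a ℕ.* suc e) (c ℕ.* suc d)) (cong₂ ℤ._+_ (ℤ.pos-* a (suc e)) (ℤ.pos-* c (suc d))))

  /-* : ∀ a c d e .{{_ : NonZero d}} .{{_ : NonZero e}} →
        (+ a / d) * (+ c / e) ≡ (+ (a ℕ.* c) / (d ℕ.* e)) {{ℕ.m*n≢0 d e}}
  /-* a c (suc d) (suc e) = toℚᵘ-injective (ℚᵘ.≃-trans (toℚᵘ-homo-* (+ a / suc d) (+ c / suc e))
    (ℚᵘ.≃-trans (ℚᵘ.*-cong (toℚᵘ-/ (+ a) (suc d)) (toℚᵘ-/ (+ c) (suc e)))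
    (ℚᵘ.≃-trans (ℚᵘ.*≡* (cong (ℤ._* (+ (suc d ℕ.* suc e))) (sym (ℤ.pos-* a c))))
                (ℚᵘ.≃-sym (toℚᵘ-/ (+ (a ℕ.* c)) (suc d ℕ.* suc e))))))

  [p+q]-p≡q : ∀ p q → (p + q) - p ≡ q
  [p+q]-p≡q = solve 2 (λ p q → (p :+ q) :- p := q) refl
    where open +-*-Solver

  [p+q]-q≡p : ∀ p q → (p + q) - q ≡ p
  [p+q]-q≡p = solve 2 (λ p q → (p :+ q) :- q := p) refl
    where open +-*-Solver

  -[p-q]≡q-p : ∀ p q → - (p - q) ≡ q - p
  -[p-q]≡q-p = solve 2 (λ p q → :- (p :- q) := q :- p) refl
    where open +-*-Solver

  ∣p-q∣≤δ : ∀ p q δ → p ℚ.≤ q + δ → q ℚ.≤ p + δ → ∣ p - q ∣ ℚ.≤ δ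
  ∣p-q∣≤δ p q δ p≤q+δ q≤p+δ with ∣p∣≡p∨∣p∣≡-p (p - q)
  ... | inj₁ ∣p-q∣≡p-q  = subst (ℚ._≤ δ) (sym ∣p-q∣≡p-q) (subst (p - q ℚ.≤_) ([p+q]-p≡q q δ) (+-monoˡ-≤ (- q) p≤q+δ))
  ... | inj₂ ∣p-q∣≡q-p = subst (ℚ._≤ δ) (sym ∣p-q∣≡q-p) (subst₂ ℚ._≤_ (sym (-[p-q]≡q-p p q)) ([p+q]-p≡q p δ) (+-monoˡ-≤ (- p) q≤p+δ))

  ≤-ℕceiling : ∀ q → Σ ℕ λ c → q ℚ.≤ + c / 1
  ≤-ℕceiling q@(ℚ.mkℚ n d-1 _) = ℤ.∣ n ∣ , toℚᵘ-cancel-≤ (ℚᵘ.≤-respʳ-≃ (ℚᵘ.≃-sym (toℚᵘ-/ (+ ℤ.∣ n ∣) 1)) (ℚᵘ.*≤* n≤∣n∣*d))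
    where
    n≤∣n∣ : ∀ n → n ℤ.≤ + ℤ.∣ n ∣
    n≤∣n∣ (+ n)      = ℤ.≤-refl
    n≤∣n∣ ℤ.-[1+ n ] = ℤ.-≤+
    n≤∣n∣*d : n ℤ.* + 1 ℤ.≤ + ℤ.∣ n ∣ ℤ.* + suc d-1
    n≤∣n∣*d = ℤ.≤-trans (ℤ.≤-reflexive (ℤ.*-identityʳ n)) (ℤ.≤-trans (n≤∣n∣ n)
              (ℤ.≤-trans (ℤ.+≤+ (ℕ.m≤m*n ℤ.∣ n ∣ (suc d-1))) (ℤ.≤-reflexive (ℤ.pos-* ℤ.∣ n ∣ (suc d-1)))))

  *-below-1/2G : ∀ {C q} c D G .{{_ : NonZero D}} .{{_ : NonZero G}} → C ℚ.≤ + c / 1 → 0ℚ ℚ.≤ q → q ℚ.≤ ½ * (+ 1 / D) →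
                 c ℕ.* G ℕ.< D → C * q ℚ.< (+ 1 / (2 ℕ.* G)) {{ℕ.m*n≢0 2 G}}
  *-below-1/2G {C} {q} c D G C≤c q≥0 q≤½/D cG<D = begin-strict
    C * q                          ≤⟨ ℚ.*-monoʳ-≤-nonNeg q {{ℚ.nonNegative q≥0}} C≤c ⟩
    + c / 1 * q                    ≤⟨ ℚ.*-monoˡ-≤-nonNeg (+ c / 1) {{ℚ.nonNegative c≥0}} q≤½/D ⟩
    + c / 1 * (½ * (+ 1 / D))      ≡⟨ trans (cong (+ c / 1 *_) (/-* 1 1 2 D)) (/-* c (1 ℕ.* 1) 1 (2 ℕ.* D) {{_}} {{2D≢0}}) ⟩
    (+ (c ℕ.* (1 ℕ.* 1)) / (1 ℕ.* (2 ℕ.* D))) {{ℕ.m*n≢0 1 (2 ℕ.* D) {{_}} {{2D≢0}}}}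
                                   <⟨ /-<-cross (c ℕ.* (1 ℕ.* 1)) 1 (1 ℕ.* (2 ℕ.* D)) (2 ℕ.* G) {{ℕ.m*n≢0 1 (2 ℕ.* D) {{_}} {{2D≢0}}}} {{ℕ.m*n≢0 2 G}}
                                        (subst₂ ℕ._<_ (e₁ c G) (e₂ D) (ℕ.*-monoʳ-< 2 cG<D)) ⟩
    (+ 1 / (2 ℕ.* G)) {{ℕ.m*n≢0 2 G}} ∎
    where
    open ℚ.≤-Reasoning
    2D≢0 = ℕ.m*n≢0 2 D
    c≥0 : 0ℚ ℚ.≤ + c / 1
    c≥0 = /-≤-cross 0 c 1 1 ℕ.z≤n
    e₁ : ∀ c G → 2 ℕ.* (c ℕ.* G) ≡ c ℕ.* (1 ℕ.* 1) ℕ.* (2 ℕ.* G)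
    e₁ = solve-∀
    e₂ : ∀ D → 2 ℕ.* D ≡ 1 ℕ.* (1 ℕ.* (2 ℕ.* D))
    e₂ = solve-∀


module BaseExpansion (b : ℕ) .{{_ : NonZero b}} where

  open import Data.Nat as ℕ using (ℕ; zero; suc; _+_; _*_; _^_; _∸_; _≤_; _<_; z≤n; z<s; NonZero)
  open import Data.Nat.Properties as ℕ
  open import Data.Nat.Tactic.RingSolver using (solve-∀)
  open import Data.Integer using (+_)
  open import Data.Rational as ℚ using (ℚ; ∣_∣; _-_)
  import Data.Rational.Properties as ℚ
  open import Relation.Binary.PropositionalEquality
  open Polynomials
  open Fractions

  infix 7.5 _/b^_
  _/b^_ : ℕ → ℕ → ℚ
  a /b^ k = (+ a ℚ./ b ^ k) {{m^n≢0 b k}}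

  expansion : ℕ → Coeffs → ℚ
  expansion T u = sumℚ T (λ k → u k /b^ suc k)

  horner : ℕ → Coeffs → ℕ
  horner zero    u = 0
  horner (suc T) u = horner T u * b + u T

  /b^-+-/b^suc : ∀ a c T → a /b^ T ℚ.+ c /b^ suc T ≡ (a * b + c) /b^ suc T
  /b^-+-/b^suc a c T = trans (/-+ a c (b ^ T) (b ^ suc T))
    (/-≡-cross (a * b ^ suc T + c * b ^ T) (a * b + c) (b ^ T * b ^ suc T) (b ^ suc T) (rearrange a c b (b ^ T)))
    where
    instance
      b^T≢0 = m^n≢0 b T
      b^1+T≢0 = m^n≢0 b (suc T)
      b^T*b^1+T≢0 = m*n≢0 (b ^ T) (b ^ suc T)
    rearrange : ∀ a c b P → (a * (b * P) + c * P) * (b * P) ≡ (a * b + c) * (P * (b * P))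
    rearrange = solve-∀

  expansion≡horner/b^T : ∀ T u → expansion T u ≡ horner T u /b^ T
  expansion≡horner/b^T zero    u = ℚ.0/n≡0 1
  expansion≡horner/b^T (suc T) u =
    trans (cong (ℚ._+ u T /b^ suc T) (expansion≡horner/b^T T u)) (/b^-+-/b^suc (horner T u) (u T) T)

  horner-+ : ∀ s t u → horner (s + t) u ≡ horner s u * b ^ t + horner t (λ k → u (s + k))
  horner-+ s zero    u = trans (cong (λ n → horner n u) (+-identityʳ s)) (sym (trans (+-identityʳ _) (*-identityʳ _)))
  horner-+ s (suc t) u = begin
    horner (s + suc t) u                                  ≡⟨ cong (λ n → horner n u) (+-suc s t) ⟩
    horner (s + t) u * b + u (s + t)                      ≡⟨ cong (λ x → x * b + u (s + t)) (horner-+ s t u) ⟩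
    (horner s u * b ^ t + tail) * b + u (s + t)           ≡⟨ rearrange (horner s u) (b ^ t) tail b (u (s + t)) ⟩
    horner s u * (b * b ^ t) + (tail * b + u (s + t))     ∎
    where
    open ≡-Reasoning
    tail = horner t (λ k → u (s + k))
    rearrange : ∀ h p x b y → (h * p + x) * b + y ≡ h * (b * p) + (x * b + y)
    rearrange = solve-∀

  horner<b^T : ∀ {u} → (∀ k → u k < b) → ∀ T → horner T u < b ^ T
  horner<b^T u<b zero    = z<s
  horner<b^T {u} u<b (suc T) = begin-strict
    horner T u * b + u T      <⟨ +-monoʳ-< (horner T u * b) (u<b T) ⟩
    horner T u * b + b        ≡⟨ +-comm (horner T u * b) b ⟩
    suc (horner T u) * b      ≤⟨ *-monoˡ-≤ b (horner<b^T u<b T) ⟩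
    b ^ T * b                 ≡⟨ *-comm (b ^ T) b ⟩
    b ^ suc T                 ∎
    where open ≤-Reasoning

  horner-zeros : ∀ {u} → (∀ k → u k ≡ 0) → ∀ T → horner T u ≡ 0
  horner-zeros u≡0 zero    = refl
  horner-zeros u≡0 (suc T) = cong₂ (λ x y → x * b + y) (horner-zeros u≡0 T) (u≡0 T)

  horner-one-prefix : ∀ {u} m → (∀ k → k ≤ m → u k ≡ one k) → horner (suc m) u ≡ b ^ m
  horner-one-prefix zero    u≡one = u≡one 0 z≤n
  horner-one-prefix (suc m) u≡one = begin
    horner (suc m) _ * b + _ ≡⟨ cong₂ (λ x y → x * b + y) (horner-one-prefix m (λ k k≤m → u≡one k (m≤n⇒m≤1+n k≤m))) (u≡one (suc m) ≤-refl) ⟩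
    b ^ m * b + 0            ≡⟨ trans (+-identityʳ _) (*-comm (b ^ m) b) ⟩
    b ^ suc m                ∎
    where open ≡-Reasoning

  horner-repdigit : ∀ {v} M → v 0 ≡ 0 → (∀ k → k < M → v (suc k) ≡ b ∸ 1) → horner (suc M) v + 1 ≡ b ^ M
  horner-repdigit zero    v0≡0 _ = cong (_+ 1) v0≡0
  horner-repdigit {v} (suc M) v0≡0 v≡b-1 = begin
    horner (suc M) v * b + v (suc M) + 1  ≡⟨ cong (λ y → horner (suc M) v * b + y + 1) (v≡b-1 M ≤-refl) ⟩
    horner (suc M) v * b + (b ∸ 1) + 1    ≡⟨ cong (λ c → horner (suc M) v * c + (b ∸ 1) + 1) (suc-pred b) ⟨
    horner (suc M) v * suc (b ∸ 1) + (b ∸ 1) + 1 ≡⟨ rearrange (horner (suc M) v) (b ∸ 1) ⟩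
    (horner (suc M) v + 1) * suc (b ∸ 1)  ≡⟨ cong₂ _*_ (horner-repdigit M v0≡0 (λ k k<M → v≡b-1 k (m<n⇒m<1+n k<M))) (suc-pred b) ⟩
    b ^ M * b                             ≡⟨ *-comm (b ^ M) b ⟩
    b ^ suc M                             ∎
    where
    open ≡-Reasoning
    rearrange : ∀ h c → h * suc c + c + 1 ≡ (h + 1) * suc c
    rearrange = solve-∀

  ∣1/b-H/b^[1+t]∣≤1/b^Q : ∀ {H Z} t Q → b ^ t ≤ H + Z → H ≤ b ^ t + Z → Z * b ^ Q ≤ b ^ suc t →
                          ∣ 1 /b^ 1 - H /b^ suc t ∣ ℚ.≤ 1 /b^ Q
  ∣1/b-H/b^[1+t]∣≤1/b^Q {H} {Z} t Q b^t≤H+Z H≤b^t+Z Zb^Q≤b^[1+t] = ∣p-q∣≤δ _ _ _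
    (subst (1 /b^ 1 ℚ.≤_) (sym (/-+ H 1 (b ^ suc t) (b ^ Q)))
           (/-≤-cross 1 (H * b ^ Q + 1 * b ^ suc t) (b ^ 1) (b ^ suc t * b ^ Q) lower))
    (subst (H /b^ suc t ℚ.≤_) (sym (/-+ 1 1 (b ^ 1) (b ^ Q)))
           (/-≤-cross H (1 * b ^ Q + 1 * b ^ 1) (b ^ suc t) (b ^ 1 * b ^ Q) upper))
    where
    instance
      b^1≢0 = m^n≢0 b 1
      b^Q≢0 = m^n≢0 b Q
      b^1+t≢0 = m^n≢0 b (suc t)
      b^1*b^Q≢0 = m*n≢0 (b ^ 1) (b ^ Q)
      b^1+t*b^Q≢0 = m*n≢0 (b ^ suc t) (b ^ Q)
    open ≤-Reasoning
    P = b ^ t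
    B = b ^ Q
    lower : 1 * (b * P * B) ≤ (H * B + 1 * (b * P)) * (b * 1)
    lower = begin
      1 * (b * P * B)               ≡⟨ e₁ b P B ⟩
      b * (P * B)                   ≤⟨ *-monoʳ-≤ b (*-monoˡ-≤ B b^t≤H+Z) ⟩
      b * ((H + Z) * B)             ≡⟨ e₂ b H Z B ⟩
      b * (H * B) + b * (Z * B)     ≤⟨ +-monoʳ-≤ (b * (H * B)) (*-monoʳ-≤ b Zb^Q≤b^[1+t]) ⟩
      b * (H * B) + b * (b * P)     ≡⟨ e₃ b H B P ⟩
      (H * B + 1 * (b * P)) * (b * 1) ∎
      where
      e₁ : ∀ b P B → 1 * (b * P * B) ≡ b * (P * B)
      e₁ = solve-∀
      e₂ : ∀ b H Z B → b * ((H + Z) * B) ≡ b * (H * B) + b * (Z * B)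
      e₂ = solve-∀
      e₃ : ∀ b H B P → b * (H * B) + b * (b * P) ≡ (H * B + 1 * (b * P)) * (b * 1)
      e₃ = solve-∀
    upper : H * (b * 1 * B) ≤ (1 * B + 1 * (b * 1)) * (b * P)
    upper = begin
      H * (b * 1 * B)               ≡⟨ e₁ H b B ⟩
      b * (H * B)                   ≤⟨ *-monoʳ-≤ b (*-monoˡ-≤ B H≤b^t+Z) ⟩
      b * ((P + Z) * B)             ≡⟨ e₂ b P Z B ⟩
      b * (P * B) + b * (Z * B)     ≤⟨ +-monoʳ-≤ (b * (P * B)) (*-monoʳ-≤ b Zb^Q≤b^[1+t]) ⟩
      b * (P * B) + b * (b * P)     ≡⟨ e₃ b P B ⟩
      (1 * B + 1 * (b * 1)) * (b * P) ∎
      where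
      e₁ : ∀ H b B → H * (b * 1 * B) ≡ b * (H * B)
      e₁ = solve-∀
      e₂ : ∀ b P Z B → b * ((P + Z) * B) ≡ b * (P * B) + b * (Z * B)
      e₂ = solve-∀
      e₃ : ∀ b P B → b * (P * B) + b * (b * P) ≡ (1 * B + 1 * (b * 1)) * (b * P)
      e₃ = solve-∀

  expansion-one-prefix : ∀ {T u} Q′ → Q′ ≤ T → (∀ k → k ≤ Q′ → u k ≡ one k) → (∀ k → u k < b) →
                         ∣ 1 /b^ 1 - expansion (suc T) u ∣ ℚ.≤ 1 /b^ suc Q′
  expansion-one-prefix {T} {u} Q′ Q′≤T prefix u<b =
    subst (λ q → ∣ 1 /b^ 1 - q ∣ ℚ.≤ 1 /b^ suc Q′) (sym (expansion≡horner/b^T (suc T) u))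
      (subst (λ n → ∣ 1 /b^ 1 - horner (suc n) u /b^ suc n ∣ ℚ.≤ 1 /b^ suc Q′) (m+[n∸m]≡n Q′≤T)
         (∣1/b-H/b^[1+t]∣≤1/b^Q (Q′ + t) (suc Q′) lower upper (≤-reflexive b^t*b^[1+Q′]≡b^[1+Q′+t])))
    where
    t = T ∸ Q′
    H = horner (suc Q′ + t) u
    tail = horner t (λ k → u (suc Q′ + k))
    split : H ≡ b ^ (Q′ + t) + tail
    split = trans (horner-+ (suc Q′) t u)
                  (cong (_+ tail) (trans (cong (_* b ^ t) (horner-one-prefix Q′ prefix)) (sym (^-distribˡ-+-* b Q′ t))))
    lower : b ^ (Q′ + t) ≤ H + b ^ t
    lower = ≤-trans (≤-trans (m≤m+n _ tail) (≤-reflexive (sym split))) (m≤m+n H (b ^ t))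
    upper : H ≤ b ^ (Q′ + t) + b ^ t
    upper = ≤-trans (≤-reflexive split) (+-monoʳ-≤ (b ^ (Q′ + t)) (<⇒≤ (horner<b^T (λ k → u<b (suc Q′ + k)) t)))
    b^t*b^[1+Q′]≡b^[1+Q′+t] : b ^ t * b ^ suc Q′ ≡ b ^ suc (Q′ + t)
    b^t*b^[1+Q′]≡b^[1+Q′+t] = trans (*-comm (b ^ t) _) (sym (^-distribˡ-+-* b (suc Q′) t))

  expansion-repdigit : ∀ {T v} M → M ≤ T → v 0 ≡ 0 → (∀ k → v (suc k) ≡ (b ∸ 1) * repunit M k) →
                       ∀ Q → Q ≤ suc M → ∣ 1 /b^ 1 - expansion (suc T) v ∣ ℚ.≤ 1 /b^ Q
  expansion-repdigit {T} {v} M M≤T v0≡0 v≡repdigit Q Q≤1+M =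
    subst (λ q → ∣ 1 /b^ 1 - q ∣ ℚ.≤ 1 /b^ Q) (sym (expansion≡horner/b^T (suc T) v))
      (subst (λ n → ∣ 1 /b^ 1 - horner (suc n) v /b^ suc n ∣ ℚ.≤ 1 /b^ Q) (m+[n∸m]≡n M≤T)
         (∣1/b-H/b^[1+t]∣≤1/b^Q (M + t) Q (≤-reflexive (sym H+b^t≡b^[M+t])) upper b^t*b^Q≤b^[1+M+t]))
    where
    t = T ∸ M
    H = horner (suc M + t) v
    v≡b-1 : ∀ k → k < M → v (suc k) ≡ b ∸ 1
    v≡b-1 k k<M = trans (v≡repdigit k) (trans (cong ((b ∸ 1) *_) (repunit-below M k k<M)) (*-identityʳ (b ∸ 1)))
    tail≡0 : ∀ k → v (suc M + k) ≡ 0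
    tail≡0 k = trans (v≡repdigit (M + k)) (trans (cong ((b ∸ 1) *_) (repunit-degree M (M + k) (m≤m+n M k))) (*-zeroʳ (b ∸ 1)))
    H+b^t≡b^[M+t] : H + b ^ t ≡ b ^ (M + t)
    H+b^t≡b^[M+t] = begin
      H + b ^ t                                   ≡⟨ cong (_+ b ^ t) (horner-+ (suc M) t v) ⟩
      horner (suc M) v * b ^ t + tail + b ^ t     ≡⟨ cong (λ x → horner (suc M) v * b ^ t + x + b ^ t) (horner-zeros tail≡0 t) ⟩
      horner (suc M) v * b ^ t + 0 + b ^ t        ≡⟨ cong (_+ b ^ t) (+-identityʳ _) ⟩
      horner (suc M) v * b ^ t + b ^ t            ≡⟨ cong (_+ b ^ t) (*-comm (horner (suc M) v) (b ^ t)) ⟩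
      b ^ t * horner (suc M) v + b ^ t            ≡⟨ trans (+-comm _ (b ^ t)) (sym (*-suc (b ^ t) _)) ⟩
      b ^ t * suc (horner (suc M) v)              ≡⟨ cong (b ^ t *_) (trans (+-comm 1 _) (horner-repdigit M v0≡0 v≡b-1)) ⟩
      b ^ t * b ^ M                               ≡⟨ trans (*-comm (b ^ t) (b ^ M)) (sym (^-distribˡ-+-* b M t)) ⟩
      b ^ (M + t)                                 ∎
      where
      open ≡-Reasoning
      tail = horner t (λ k → v (suc M + k))
    upper : H ≤ b ^ (M + t) + b ^ t
    upper = ≤-trans (m≤m+n H (b ^ t)) (≤-trans (≤-reflexive H+b^t≡b^[M+t]) (m≤m+n _ (b ^ t)))
    b^t*b^Q≤b^[1+M+t] : b ^ t * b ^ Q ≤ b ^ suc (M + t)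
    b^t*b^Q≤b^[1+M+t] = ≤-trans (*-monoʳ-≤ (b ^ t) (^-monoʳ-≤ b Q≤1+M))
                                 (≤-reflexive (trans (*-comm (b ^ t) _) (sym (^-distribˡ-+-* b (suc M) t))))


module SeparationRadius where

  open import Data.Nat as ℕ using (ℕ; zero; suc; _∸_; s≤s)
  import Data.Nat.Properties as ℕ
  open import Data.Rational as ℚ using (ℚ; 0ℚ; ½; _*_; ∣_∣; _-_)
  import Data.Rational.Properties as ℚ
  open import Data.Fin using (Fin)
  open import Data.Sum using ([_,_]′)
  open import Relation.Binary.PropositionalEquality

  minUpTo-≤ : ∀ N f i → i ℕ.< N → minUpTo N f ℚ.≤ f i
  minUpTo-≤ (suc zero)    f zero    _           = ℚ.≤-refl
  minUpTo-≤ (suc zero)    f (suc i) (s≤s ())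
  minUpTo-≤ (suc (suc N)) f i       i<2+N       = [ (λ i<1+N → ℚ.p≤q⇒p⊓r≤q (f (suc N)) (minUpTo-≤ (suc N) f i i<1+N))
                                                  , (λ { refl → ℚ.p⊓q≤q (minUpTo (suc N) f) (f (suc N)) }) ]′
                                                    (ℕ.m≤n⇒m<n∨m≡n (ℕ.≤-pred i<2+N))

  minUpTo-nonNeg : ∀ N f → (∀ i → 0ℚ ℚ.≤ f i) → 0ℚ ℚ.≤ minUpTo N f
  minUpTo-nonNeg zero          f f≥0 = ℚ.≤-refl
  minUpTo-nonNeg (suc zero)    f f≥0 = f≥0 0
  minUpTo-nonNeg (suc (suc N)) f f≥0 = ℚ.⊓-glb (minUpTo-nonNeg (suc N) f f≥0) (f≥0 (suc N))

  maxFin-ub : ∀ {d} (f : Fin d → ℚ) i → f i ℚ.≤ maxFin f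
  maxFin-ub f Fin.zero    = ℚ.p≤p⊔q _ _
  maxFin-ub f (Fin.suc i) = ℚ.p≤q⇒p≤r⊔q (f Fin.zero) (maxFin-ub (λ i → f (Fin.suc i)) i)

  maxFin-lub : ∀ {d} (f : Fin d → ℚ) δ → 0ℚ ℚ.≤ δ → (∀ i → f i ℚ.≤ δ) → maxFin f ℚ.≤ δ
  maxFin-lub {zero}  f δ δ≥0 f≤δ = δ≥0
  maxFin-lub {suc d} f δ δ≥0 f≤δ = ℚ.⊔-lub (f≤δ Fin.zero) (maxFin-lub (λ i → f (Fin.suc i)) δ δ≥0 (λ i → f≤δ (Fin.suc i)))

  maxFin-nonNeg : ∀ {d} (f : Fin d → ℚ) → (∀ i → 0ℚ ℚ.≤ f i) → 0ℚ ℚ.≤ maxFin f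
  maxFin-nonNeg {zero}  f f≥0 = ℚ.≤-refl
  maxFin-nonNeg {suc d} f f≥0 = ℚ.≤-trans (f≥0 Fin.zero) (ℚ.p≤p⊔q _ _)

  dist∞-nonNeg : ∀ {d} (x y : Fin d → ℚ) → 0ℚ ℚ.≤ dist∞ x y
  dist∞-nonNeg x y = maxFin-nonNeg (λ i → ∣ x i - y i ∣) (λ i → ℚ.0≤∣p∣ (x i - y i))

  ½-nonNeg : 0ℚ ℚ.≤ ½
  ½-nonNeg = ℚ.<⇒≤ (ℚ.positive⁻¹ ½)

  sepRadius-nonNeg : ∀ {d} (p : ℕ → Fin d → ℚ) N → 0ℚ ℚ.≤ sepRadius p N
  sepRadius-nonNeg p N = subst (ℚ._≤ sepRadius p N) (ℚ.*-zeroʳ ½)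
    (ℚ.*-monoˡ-≤-nonNeg ½ {{ℚ.nonNegative ½-nonNeg}}
      (minUpTo-nonNeg (N ∸ 1) _ (λ n → minUpTo-nonNeg (suc n) _ (λ m → dist∞-nonNeg (p m) (p (suc n))))))

  sepRadius-≤ : ∀ {d} (p : ℕ → Fin d → ℚ) N {m n} → m ℕ.< n → n ℕ.< N → sepRadius p N ℚ.≤ ½ * dist∞ (p m) (p n)
  sepRadius-≤ p (suc N) {m} {suc n} m<1+n 1+n<1+N = ℚ.*-monoˡ-≤-nonNeg ½ {{ℚ.nonNegative ½-nonNeg}}
    (ℚ.≤-trans (minUpTo-≤ N _ n (ℕ.≤-pred 1+n<1+N)) (minUpTo-≤ (suc n) _ m m<1+n))


module FillDistance where

  open import Data.Nat as ℕ using (ℕ; zero; suc; _+_; _*_; _^_; NonZero; z≤n)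
  import Data.Nat.Properties as ℕ
  open import Data.Nat.Tactic.RingSolver using (solve-∀)
  open import Data.Integer using (+_)
  open import Data.Rational as ℚ using (ℚ; _/_; 0ℚ; 1ℚ; ∣_∣; _-_; -_)
  open import Data.Rational.Properties as ℚ using (_≤?_; _<?_)
  open import Data.Fin as Fin using (Fin; toℕ; fromℕ<; finToFun; funToFin; combine)
  open import Data.Fin.Properties using (any?; all?; ¬∀⟶∃¬; pigeonhole; toℕ-injective; toℕ-fromℕ<; toℕ<n; funToFin-finToFin)
  open import Data.Product using (Σ; _×_; _,_; proj₁; proj₂)
  open import Relation.Nullary using (¬_; yes; no; Dec; contradiction)
  open import Relation.Nullary.Decidable using (¬?; _×-dec_; decidable-stable)
  open import Relation.Binary.PropositionalEquality
  open Fractions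
  open SeparationRadius

  funToFin-cong : ∀ {m n} {f g : Fin m → Fin n} → (∀ i → f i ≡ g i) → funToFin f ≡ funToFin g
  funToFin-cong {zero}  f≡g = refl
  funToFin-cong {suc m} f≡g = cong₂ combine (f≡g Fin.zero) (funToFin-cong (λ i → f≡g (Fin.suc i)))

  δ≤p⇒δ≤∣p∣ : ∀ {δ p} → 0ℚ ℚ.≤ δ → δ ℚ.≤ p → δ ℚ.≤ ∣ p ∣
  δ≤p⇒δ≤∣p∣ {δ} {p} δ≥0 δ≤p = subst (δ ℚ.≤_) (sym (ℚ.0≤p⇒∣p∣≡p (ℚ.≤-trans δ≥0 δ≤p))) δ≤p

  module Grid (G : ℕ) .{{_ : NonZero G}} where

    private instance
      2G≢0 : NonZero (2 * G)
      2G≢0 = ℕ.m*n≢0 2 G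

    lo hi ctr : ℕ → ℚ
    lo  a = + a / G
    hi  a = + suc a / G
    ctr a = + (2 * a + 1) / (2 * G)

    δ : ℚ
    δ = + 1 / (2 * G)

    InCell : ℕ → ℚ → Set
    InCell a y = (lo a ℚ.≤ y) × (y ℚ.< hi a)

    inCell? : ∀ a y → Dec (InCell a y)
    inCell? a y = (lo a ≤? y) ×-dec (y <? hi a)

    inCell-≤ : ∀ {a a′ y} → InCell a y → InCell a′ y → a ℕ.≤ a′
    inCell-≤ {a} {a′} (lo≤y , _) (_ , y<hi′) = ℕ.≮⇒≥ (λ a′<a → ℚ.<-irrefl refl
      (ℚ.<-≤-trans (ℚ.≤-<-trans lo≤y y<hi′) (/-≤-cross (suc a′) a G G (ℕ.*-monoˡ-≤ G a′<a))))

    inCell-unique : ∀ {a a′ y} → InCell a y → InCell a′ y → a ≡ a′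
    inCell-unique a∋y a′∋y = ℕ.≤-antisym (inCell-≤ a∋y a′∋y) (inCell-≤ a′∋y a∋y)

    δ-nonNeg : 0ℚ ℚ.≤ δ
    δ-nonNeg = /-≤-cross 0 1 1 (2 * G) z≤n

    δ+lo≡ctr : ∀ a → δ ℚ.+ lo a ≡ ctr a
    δ+lo≡ctr a = trans (/-+ 1 a (2 * G) G) (/-≡-cross (1 * G + a * (2 * G)) (2 * a + 1) (2 * G * G) (2 * G) {{ℕ.m*n≢0 (2 * G) G}} (e a G))
      where
      e : ∀ a G → (1 * G + a * (2 * G)) * (2 * G) ≡ (2 * a + 1) * (2 * G * G)
      e = solve-∀

    ctr+δ≡hi : ∀ a → ctr a ℚ.+ δ ≡ hi a
    ctr+δ≡hi a = trans (/-+ (2 * a + 1) 1 (2 * G) (2 * G)) (/-≡-cross ((2 * a + 1) * (2 * G) + 1 * (2 * G)) (suc a) (2 * G * (2 * G)) G {{ℕ.m*n≢0 (2 * G) (2 * G)}} (e a G))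
      where
      e : ∀ a G → ((2 * a + 1) * (2 * G) + 1 * (2 * G)) * G ≡ suc a * (2 * G * (2 * G))
      e = solve-∀

    ctr-inUnit : ∀ {a} → a ℕ.< G → (0ℚ ℚ.≤ ctr a) × (ctr a ℚ.≤ 1ℚ)
    ctr-inUnit {a} a<G = /-≤-cross 0 (2 * a + 1) 1 (2 * G) z≤n , /-≤-cross (2 * a + 1) 1 (2 * G) 1 2a+2≤2G
      where
      2a+2≤2G : (2 * a + 1) * 1 ℕ.≤ 1 * (2 * G)
      2a+2≤2G = begin
        (2 * a + 1) * 1   ≤⟨ ℕ.n≤1+n _ ⟩
        suc ((2 * a + 1) * 1) ≡⟨ e a ⟩
        2 * suc a         ≤⟨ ℕ.*-monoʳ-≤ 2 a<G ⟩
        2 * G             ≡⟨ ℕ.*-identityˡ (2 * G) ⟨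
        1 * (2 * G)       ∎
        where
        open ℕ.≤-Reasoning
        e : ∀ a → suc ((2 * a + 1) * 1) ≡ 2 * suc a
        e = solve-∀

    -- y ∉ [lo a, hi a) means y < lo a = ctr a − δ or y ≥ hi a = ctr a + δ.
    far-from-ctr : ∀ a y → ¬ InCell a y → δ ℚ.≤ ∣ ctr a - y ∣
    far-from-ctr a y y∉a with lo a ≤? y
    ... | no lo≰y = δ≤p⇒δ≤∣p∣ δ-nonNeg (subst (ℚ._≤ ctr a - y) ([p+q]-q≡p δ y)
                      (ℚ.+-monoˡ-≤ (- y) (subst (δ ℚ.+ y ℚ.≤_) (δ+lo≡ctr a) (ℚ.+-monoʳ-≤ δ (ℚ.<⇒≤ (ℚ.≰⇒> lo≰y))))))
    ... | yes lo≤y with y <? hi a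
    ...   | yes y<hi = contradiction (lo≤y , y<hi) y∉a
    ...   | no y≮hi  = subst (δ ℚ.≤_) (trans (sym (ℚ.∣-p∣≡∣p∣ (y - ctr a))) (cong ∣_∣ (-[p-q]≡q-p y (ctr a))))
                         (δ≤p⇒δ≤∣p∣ δ-nonNeg (subst (ℚ._≤ y - ctr a) ([p+q]-p≡q (ctr a) δ)
                           (ℚ.+-monoˡ-≤ (- ctr a) (subst (ℚ._≤ y) (sym (ctr+δ≡hi a)) (ℚ.≮⇒≥ y≮hi)))))

    module _ {d : ℕ} (p : ℕ → (Fin d → ℚ)) (N : ℕ) (N<G^d : N ℕ.< G ^ d) where

      -- Boxes are indexed by Fin (G ^ d), read as the cell coordinates Fin d → Fin G via finToFun.
      cell : Fin (G ^ d) → Fin d → ℕ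
      cell c i = toℕ (finToFun {G} {d} c i)

      InBox : Fin (G ^ d) → (Fin d → ℚ) → Set
      InBox c y = ∀ i → InCell (cell c i) (y i)

      inBox? : ∀ c y → Dec (InBox c y)
      inBox? c y = all? (λ i → inCell? (cell c i) (y i))

      point : Fin N → Fin d → ℚ
      point n = p (toℕ n)

      -- Some box contains none of the N points (pigeonhole), and its centre is δ-far from all of them.
      emptyBox-centre : Σ (Fin d → ℚ) λ x → InCube x × (∀ n → n ℕ.< N → δ ℚ.≤ dist∞ x (p n))
      emptyBox-centre with any? (λ c → all? (λ n → ¬? (inBox? c (point n))))
      ... | yes (c , empty) = x , x∈cube , far
        where
        x : Fin d → ℚ
        x i = ctr (cell c i)
        x∈cube : InCube x
        x∈cube i = ctr-inUnit (toℕ<n (finToFun {G} {d} c i))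
        far : ∀ n → n ℕ.< N → δ ℚ.≤ dist∞ x (p n)
        far n n<N with ¬∀⟶∃¬ d _ (λ i → inCell? (cell c i) (p n i))
                         (subst (λ m → ¬ InBox c (p m)) (toℕ-fromℕ< n<N) (empty (fromℕ< n<N)))
        ... | (i , pₙᵢ∉cell) = ℚ.≤-trans (far-from-ctr (cell c i) (p n i) pₙᵢ∉cell) (maxFin-ub (λ i → ∣ x i - p n i ∣) i)
      ... | no noEmptyBox = contradiction (cong toℕ c≡c′) (ℕ.<⇒≢ c<c′)
        where
        occupant : ∀ c → Σ (Fin N) λ n → InBox c (point n)
        occupant c with ¬∀⟶∃¬ N _ (λ n → ¬? (inBox? c (point n))) (λ empty → noEmptyBox (c , empty))
        ... | (n , ¬¬n∈c) = n , decidable-stable (inBox? c (point n)) ¬¬n∈c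
        collision = pigeonhole N<G^d (λ c → proj₁ (occupant c))
        c c′ : Fin (G ^ d)
        c  = proj₁ collision
        c′ = proj₁ (proj₂ collision)
        c<c′ = proj₁ (proj₂ (proj₂ collision))
        same-occupant = proj₂ (proj₂ (proj₂ collision))
        y = point (proj₁ (occupant c))
        y∈c′ : InBox c′ y
        y∈c′ = subst (λ n → InBox c′ (point n)) (sym same-occupant) (proj₂ (occupant c′))
        c≡c′ : c ≡ c′
        c≡c′ = trans (sym (funToFin-finToFin {d} {G} c))
               (trans (funToFin-cong (λ i → toℕ-injective (inCell-unique (proj₂ (occupant c) i) (y∈c′ i))))
                      (funToFin-finToFin {d} {G} c′))


module FaurePoints {b : ℕ} (pr : Prime b) where

  open import Data.Nat as ℕ using (ℕ; zero; suc; _*_; _^_; _∸_; _≤_; _<_; s≤s; z≤n; z<s; NonZero; nonTrivial⇒n>1)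
  open import Data.Nat.Tactic.RingSolver using (solve-∀)
  open import Data.Nat.Properties as ℕ
  open import Data.Nat.DivMod using (m%n<n)
  open import Data.Nat.Primality using (Prime; prime⇒nonZero; prime⇒nonTrivial)
  open import Data.Fin using (toℕ)
  open import Data.Fin.Properties using (toℕ<n)
  open import Data.Rational as ℚ using (∣_∣; _-_)
  open import Relation.Binary.PropositionalEquality
  open Polynomials
  open PascalMatrix
  open RepunitsUnderPascal
  open Fractions
  open SeparationRadius

  private instance
    b-nonZero : NonZero b
    b-nonZero = prime⇒nonZero pr

  1<b : 1 < b
  1<b = nonTrivial⇒n>1 b ⦃ prime⇒nonTrivial pr ⦄

  open Congruence b using (≡ₘ-trans; ≡ₘ⇒≡)
  open CoeffCongruence b using (_≈_; ≡⇒≈)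
  open BaseExpansion b
  open Digits 1<b

  faure-digit<b : ∀ n j k → powP b (suc n) j (digit b n) k < b
  faure-digit<b n zero    zero    = m%n<n n b
  faure-digit<b n zero    (suc k) = faure-digit<b (n ℕ./ b) zero k
  faure-digit<b n (suc j) k       = m%n<n _ b

  faure-1 : ∀ j → faure b 1 j ≡ 1 /b^ 1
  faure-1 j = begin
    expansion 2 u    ≡⟨ expansion≡horner/b^T 2 u ⟩
    horner 2 u /b^ 2 ≡⟨ cong (_/b^ 2) (horner-one-prefix 1 (λ k _ → u≡one k)) ⟩
    b ^ 1 /b^ 2      ≡⟨ /-≡-cross (b ^ 1) 1 (b ^ 2) (b ^ 1) {{m^n≢0 b 2}} {{m^n≢0 b 1}} (b^1*b^1≡1*b^2 b) ⟩
    1 /b^ 1          ∎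
    where
    open ≡-Reasoning
    open Pascal b 1
    u = P^ toℕ j · digit b 1
    u≡one : ∀ k → u k ≡ one k
    u≡one k = ≡ₘ⇒≡ (faure-digit<b 1 (toℕ j) k) (one<b 1<b k) (≡ₘ-trans (P^-cong (toℕ j) (≡⇒≈ digit-one) k) (P^-one (toℕ j) k))
    b^1*b^1≡1*b^2 : ∀ b → b * 1 * (b * 1) ≡ 1 * (b * (b * 1))
    b^1*b^1≡1*b^2 = solve-∀

  faure-repdigit*b-near-1/b : ∀ r M Q′ → suc M ≡ (b ∸ 1) * b ^ r → suc M < repdigit M * b →
                              suc (suc Q′) ≤ b ^ r → Q′ ≤ M →
                              ∀ j → ∣ 1 /b^ 1 - faure b (repdigit M * b) j ∣ ℚ.≤ 1 /b^ suc Q′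
  faure-repdigit*b-near-1/b r M Q′ 1+M≡L 1+M<n Q′+2≤R Q′≤M j with toℕ j | toℕ<n j
  ... | zero   | _   = expansion-repdigit {v = digit b (repdigit M * b)} M M≤n (digit-*b-zero (repdigit M)) (digit-repdigit*b M) (suc Q′) (s≤s Q′≤M)
    where M≤n = <⇒≤ (<-trans (n<1+n M) 1+M<n)
  ... | suc j′ | j<b = expansion-one-prefix Q′ (≤-trans Q′≤M (<⇒≤ (<-trans (n<1+n M) 1+M<n))) prefix (faure-digit<b n (suc j′))
    where
    n = repdigit M * b
    open Pascal b n using (P^_·_)
    open PascalPowerOfRepunit pr r (subst (_< n) 1+M≡L 1+M<n) {suc j′} z<s j<b
    prefix : ∀ k → k ≤ Q′ → (P^ suc j′ · digit b n) k ≡ one k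
    prefix k k≤Q′ = P^j-low-digits (digit b n) (subst (λ L → digit b n ⊕ repunit L ≈ one) 1+M≡L (digit-repdigit*b+repunit≈one M))
                                   k (≤-trans (s≤s (s≤s k≤Q′)) Q′+2≤R)

  dist-faure-1-repdigit*b : ∀ r M Q′ → suc M ≡ (b ∸ 1) * b ^ r → suc M < repdigit M * b →
                            suc (suc Q′) ≤ b ^ r → Q′ ≤ M →
                            dist∞ (faure b 1) (faure b (repdigit M * b)) ℚ.≤ 1 /b^ suc Q′
  dist-faure-1-repdigit*b r M Q′ 1+M≡L 1+M<n Q′+2≤R Q′≤M =
    maxFin-lub _ _ (/-≤-cross 0 1 1 (b ^ suc Q′) {{_}} {{m^n≢0 b (suc Q′)}} z≤n) (λ j →
      subst (λ q → ∣ q - faure b (repdigit M * b) j ∣ ℚ.≤ 1 /b^ suc Q′) (sym (faure-1 j))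
            (faure-repdigit*b-near-1/b r M Q′ 1+M≡L 1+M<n Q′+2≤R Q′≤M j))


module Parameters {b : ℕ} .{{_ : NonZero b}} (1<b : 1 < b) (c : ℕ) where

  open import Data.Nat
  open import Data.Nat.Properties
  open import Data.Nat.Tactic.RingSolver using (solve-∀)
  open import Relation.Binary.PropositionalEquality

  open Digits 1<b using (1≤b-1; repdigit; repdigit+1≡b^m; m≤repdigit)

  -- Points 1 and n = b^L − b agree up to b^−(Q′+1), where Q′ + 2 = R = b^(c+2), while boxes of side
  -- 1/G, G^b = b^L, leave an empty one; c · G < b^(Q′+1) then puts the mesh ratio above c.
  P R K L M Q′ n G : ℕ
  P  = b ^ suc c
  R  = b * P
  K  = (b ∸ 1) * P
  L  = (b ∸ 1) * R
  M  = pred L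
  Q′ = K + (P ∸ 2)
  n  = repdigit M * b
  G  = b ^ K

  instance
    G-nonZero : NonZero G
    G-nonZero = m^n≢0 b K

  m<b^m : ∀ m → m < b ^ m
  m<b^m zero    = z<s
  m<b^m (suc m) = begin-strict
    suc m          ≤⟨ m<b^m m ⟩
    b ^ m          <⟨ m<m*n (b ^ m) b {{m^n≢0 b m}} 1<b ⟩
    b ^ m * b      ≡⟨ *-comm (b ^ m) b ⟩
    b ^ suc m      ∎
    where open ≤-Reasoning

  2≤P : 2 ≤ P
  2≤P = ≤-trans 1<b (m≤m*n b (b ^ c) {{m^n≢0 b c}})

  R≤L : R ≤ L
  R≤L = ≤-trans (≤-reflexive (sym (*-identityˡ R))) (*-monoˡ-≤ R 1≤b-1)

  4≤L : 4 ≤ L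
  4≤L = ≤-trans (*-mono-≤ 1<b 2≤P) R≤L

  1+M≡L : suc M ≡ L
  1+M≡L = suc-pred L {{>-nonZero (≤-trans (s≤s z≤n) 4≤L)}}

  Q′+2≡R : suc (suc Q′) ≡ R
  Q′+2≡R = begin
    suc (suc (K + (P ∸ 2))) ≡⟨ trans (+-suc K (suc (P ∸ 2))) (cong suc (+-suc K (P ∸ 2))) ⟨
    K + (2 + (P ∸ 2))       ≡⟨ cong (K +_) (m+[n∸m]≡n 2≤P) ⟩
    (b ∸ 1) * P + P         ≡⟨ +-comm ((b ∸ 1) * P) P ⟩
    suc (b ∸ 1) * P         ≡⟨ cong (_* P) (suc-pred b) ⟩
    R                       ∎
    where open ≡-Reasoning

  Q′≤M : Q′ ≤ M
  Q′≤M = ≤-pred (≤-pred (≤-trans (≤-reflexive Q′+2≡R) (≤-trans R≤L (≤-trans (≤-reflexive (sym 1+M≡L)) (n≤1+n (suc M))))))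

  1+M<n : suc M < n
  1+M<n = begin-strict
    suc M                   ≡⟨ +-comm 1 M ⟩
    M + 1                   <⟨ +-monoʳ-< M 1<M ⟩
    M + M                   ≤⟨ +-mono-≤ (m≤repdigit M) (m≤repdigit M) ⟩
    repdigit M + repdigit M ≡⟨ cong (repdigit M +_) (sym (+-identityʳ (repdigit M))) ⟩
    2 * repdigit M          ≡⟨ *-comm 2 (repdigit M) ⟩
    repdigit M * 2          ≤⟨ *-monoʳ-≤ (repdigit M) 1<b ⟩
    n                       ∎
    where
    open ≤-Reasoning
    1<M : 1 < M
    1<M = ≤-pred (≤-trans (s≤s (s≤s (s≤s z≤n))) (≤-trans 4≤L (≤-reflexive (sym 1+M≡L))))

  1<n : 1 < n
  1<n = ≤-<-trans (s≤s z≤n) 1+M<n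

  2≤1+n : 2 ≤ suc n
  2≤1+n = <⇒≤ (s≤s 1<n)

  1+n<G^b : suc n < G ^ b
  1+n<G^b = begin-strict
    suc n                   ≡⟨ +-comm 1 n ⟩
    repdigit M * b + 1      <⟨ +-monoʳ-< (repdigit M * b) 1<b ⟩
    repdigit M * b + b      ≡⟨ +-comm (repdigit M * b) b ⟩
    suc (repdigit M) * b    ≡⟨ cong (_* b) (trans (+-comm 1 (repdigit M)) (repdigit+1≡b^m M)) ⟩
    b ^ M * b               ≡⟨ *-comm (b ^ M) b ⟩
    b ^ suc M               ≡⟨ cong (b ^_) (trans 1+M≡L (L≡K*b (b ∸ 1) P b)) ⟩
    b ^ (K * b)             ≡⟨ ^-*-assoc b K b ⟨
    G ^ b                   ∎
    where
    open ≤-Reasoning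
    L≡K*b : ∀ x P b → x * (b * P) ≡ x * P * b
    L≡K*b = solve-∀

  c*G<b^[1+Q′] : c * G < b ^ suc Q′
  c*G<b^[1+Q′] = begin-strict
    c * G                 <⟨ *-monoˡ-< G {{m^n≢0 b K}} c<b^[P-1] ⟩
    b ^ suc (P ∸ 2) * G   ≡⟨ *-comm (b ^ suc (P ∸ 2)) G ⟩
    G * b ^ suc (P ∸ 2)   ≡⟨ ^-distribˡ-+-* b K (suc (P ∸ 2)) ⟨
    b ^ (K + suc (P ∸ 2)) ≡⟨ cong (b ^_) (+-suc K (P ∸ 2)) ⟩
    b ^ suc Q′            ∎
    where
    open ≤-Reasoning
    c<P-1 : c < suc (P ∸ 2)
    c<P-1 = ≤-pred (≤-trans (m<b^m (suc c)) (≤-reflexive (sym (m+[n∸m]≡n 2≤P))))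
    c<b^[P-1] : c < b ^ suc (P ∸ 2)
    c<b^[P-1] = <-trans c<P-1 (m<b^m (suc (P ∸ 2)))


open Fractions using (≤-ℕceiling; *-below-1/2G)
open SeparationRadius using (½-nonNeg; sepRadius-nonNeg; sepRadius-≤)
open FillDistance using (module Grid)

mainTheorem10 : (b : ℕ) → (pr : Prime b) → (C : ℚ) →
    Σ ℕ λ N → (2 ≤ N) × MeshRatioExceeds (faure b {{primeNZ pr}}) N C
mainTheorem10 b pr C =
  let x , x∈cube , far = emptyBox-centre (faure b) (suc n) 1+n<G^b
  in  suc n , 2≤1+n , x , x∈cube , λ m m<1+n → ℚ.<-≤-trans C·sepRadius<δ (far m m<1+n)
  where
  instance
    b-nonZero : NonZero b
    b-nonZero = primeNZ pr
  c = proj₁ (≤-ℕceiling C)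
  open Parameters (nonTrivial⇒n>1 b {{prime⇒nonTrivial pr}}) c
  open FaurePoints pr
  open BaseExpansion b using (_/b^_)
  open Grid G
  sepRadius≤ : sepRadius (faure b) (suc n) ℚ.≤ ½ ℚ.* 1 /b^ suc Q′
  sepRadius≤ = ℚ.≤-trans (sepRadius-≤ (faure b) (suc n) 1<n (ℕ.n<1+n n))
    (ℚ.*-monoˡ-≤-nonNeg ½ {{ℚ.nonNegative ½-nonNeg}}
      (dist-faure-1-repdigit*b (suc (suc c)) M Q′ 1+M≡L 1+M<n (ℕ.≤-reflexive Q′+2≡R) Q′≤M))
  C·sepRadius<δ : C ℚ.* sepRadius (faure b) (suc n) ℚ.< δ
  C·sepRadius<δ = *-below-1/2G c (b ℕ.^ suc Q′) G {{ℕ.m^n≢0 b (suc Q′)}}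
    (proj₂ (≤-ℕceiling C)) (sepRadius-nonNeg (faure b) (suc n)) sepRadius≤ c*G<b^[1+Q′]
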